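{- Let $p$ be an odd prime, $q=p^s$ with $s\ge 1$, and $\mathbb{A}=\mathbb{F}_q[X]$. Then for every polynomial $f\in\mathbb{A}$ with $\deg f\ge 1$, $$G(f)\equiv\begin{cases}-1 \pmod f & \text{if } f \text{ has only one prime divisor},\\ 1 \pmod f & \text{otherwise}.\end{cases}$$
   Context: For $f\in\mathbb{A}$ with $\deg f\ge 1$, the Gauss factorial is $G(f)=\prod g$, the product over all non-zero $g\in\mathbb{A}$ with $0\le \deg g<\deg f$ and $\gcd(g,f)=1$. A prime divisor of $f$ is a monic irreducible polynomial dividing $f$. -}

module Defs where

open import Data.Nat as ℕ using (ℕ; zero; suc; _∸_)
open import Data.List using (List; []; _∷_; map; foldr; length)
open import Data.List.Relation.Unary.All using (All)
open import Data.List.Relation.Unary.Any using (Any)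
open import Data.List.Relation.Unary.AllPairs using (AllPairs)
open import Data.List.Relation.Unary.Unique.Propositional using (Unique)
open import Data.List.Membership.Propositional using (_∈_)
open import Data.Product using (Σ; ∃; _×_)
open import Data.Sum using (_⊎_)
open import Algebra.Structures using (IsCommutativeRing)
open import Relation.Binary.PropositionalEquality using (_≡_)
open import Relation.Binary.Definitions using (DecidableEquality)
open import Relation.Nullary using (¬_; yes; no)

record FiniteField : Set₁ where
  field
    Carrier  : Set
    _+_ _*_  : Carrier → Carrier → Carrier
    -_       : Carrier → Carrier
    0# 1#    : Carrier
    isCommutativeRing : IsCommutativeRing _≡_ _+_ _*_ -_ 0# 1#
    0≢1      : ¬ (0# ≡ 1#)
    inverse  : ∀ x → ¬ (x ≡ 0#) → ∃ λ y → x * y ≡ 1#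
    _≟_      : DecidableEquality Carrier
    elements : List Carrier
    elements-unique   : Unique elements
    elements-complete : ∀ x → x ∈ elements

  size : ℕ
  size = length elements

-- The polynomial ring A = F[X].  A polynomial is a list of coefficients,
-- constant term first; polynomials are compared coefficientwise (so trailing
-- zero coefficients are irrelevant).
module Poly (F : FiniteField) where
  open FiniteField F

  Pol : Set
  Pol = List Carrier

  coeff : Pol → ℕ → Carrier
  coeff []      n       = 0#
  coeff (a ∷ p) zero    = a
  coeff (a ∷ p) (suc n) = coeff p n

  _≈_ : Pol → Pol → Set
  p ≈ q = ∀ n → coeff p n ≡ coeff q n

  zeroP : Pol
  zeroP = []

  oneP : Pol
  oneP = 1# ∷ []

  _⊕_ : Pol → Pol → Pol
  []      ⊕ q       = q
  (a ∷ p) ⊕ []      = a ∷ p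
  (a ∷ p) ⊕ (b ∷ q) = (a + b) ∷ (p ⊕ q)

  negP : Pol → Pol
  negP = map -_

  _⊖_ : Pol → Pol → Pol
  p ⊖ q = p ⊕ negP q

  _⊗_ : Pol → Pol → Pol
  []      ⊗ q = []
  (a ∷ p) ⊗ q = map (a *_) q ⊕ (0# ∷ (p ⊗ q))

  prodP : List Pol → Pol
  prodP = foldr _⊗_ oneP

  consN : Carrier → Pol → Pol
  consN a [] with a ≟ 0#
  ... | yes _ = []
  ... | no  _ = a ∷ []
  consN a (b ∷ r) = a ∷ b ∷ r

  strip : Pol → Pol
  strip []      = []
  strip (a ∷ p) = consN a (strip p)

  -- degree (the zero polynomial gets degree 0 by convention; it is only
  -- ever applied to non-zero polynomials below, or in "deg f ≥ 1")
  deg : Pol → ℕ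
  deg p = length (strip p) ∸ 1

  lc : Pol → Carrier
  lc p = coeff p (deg p)

  Monic : Pol → Set
  Monic p = lc p ≡ 1#

  _∣_ : Pol → Pol → Set
  d ∣ p = ∃ λ h → p ≈ (d ⊗ h)

  IsUnit : Pol → Set
  IsUnit u = u ∣ oneP

  Irreducible : Pol → Set
  Irreducible p = ¬ (p ≈ zeroP) × ¬ IsUnit p
                × (∀ a b → p ≈ (a ⊗ b) → IsUnit a ⊎ IsUnit b)

  PrimeDivisor : Pol → Pol → Set
  PrimeDivisor P f = Monic P × Irreducible P × P ∣ f

  OnePrimeDivisor : Pol → Set
  OnePrimeDivisor f = ∃ λ P → PrimeDivisor P f × (∀ Q → PrimeDivisor Q f → Q ≈ P)

  Coprime : Pol → Pol → Set
  Coprime g f = ∀ d → d ∣ g → d ∣ f → IsUnit d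

  _≡_[mod_] : Pol → Pol → Pol → Set
  a ≡ b [mod f ] = f ∣ (a ⊖ b)

  GaussIndex : Pol → Pol → Set
  GaussIndex f g = ¬ (g ≈ zeroP) × ℕ._<_ (deg g) (deg f) × Coprime g f

  -- L lists every element of the index set of G(f) exactly once
  -- (up to equality of polynomials); G(f) is then prodP L.
  GaussEnumeration : Pol → List Pol → Set
  GaussEnumeration f L = All (GaussIndex f) L
                       × AllPairs (λ a b → ¬ (a ≈ b)) L
                       × (∀ g → GaussIndex f g → Any (g ≈_) L)

{-# OPTIONS --safe #-}
module Submission where

-- Pairing every unit of A/(f) with its inverse leaves in G(f) only the product
-- of the square roots of unity modulo f. If f = Pᵉ, then P divides x - 1 or
-- x + 1 but not both (2 is a unit since q is odd), so the only roots are ±1 and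
-- G(f) ≡ -1. Otherwise f = Pᵉ m with P ∤ m and m not a unit, and the Chinese
-- remainder theorem gives a root a ≢ ±1. Multiplication by -1, by a and by -a
-- are then fixed-point-free involutions of the set T of roots, so with |T| = 2n
-- we get ∏ T ≡ (-1)ⁿ ≡ aⁿ ≡ (-a)ⁿ = (-1)ⁿ aⁿ ≡ (∏ T)², hence ∏ T ≡ 1.

open import Defs
open import Data.Nat using (ℕ; _≥_; _^_; _%_)
open import Data.Nat.Primality using (Prime)
open import Data.List using (List)
open import Data.Product using (_×_)
open import Relation.Binary.PropositionalEquality using (_≡_)
open import Relation.Nullary using (¬_)

open import Algebra.Bundles using (RawRing; CommutativeRing; CommutativeMonoid)
open import Algebra.Solver.Ring.AlmostCommutativeRing
  using (fromCommutativeRing; _-Raw-AlmostCommutative⟶_; Induced-equivalence)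
open import Data.Empty using (⊥; ⊥-elim)
open import Data.List using ([]; _∷_; foldr; length; filter; map; cartesianProductWith)
open import Data.List.Properties using (filter-reject; filter-none)
open import Data.List.Membership.Propositional using (_∈_; find)
open import Data.List.Membership.Propositional.Properties using (∈-cartesianProductWith⁺)
open import Data.List.Relation.Unary.All as All using (All; []; _∷_)
import Data.List.Relation.Unary.All.Properties as All
open import Data.List.Relation.Unary.AllPairs using (AllPairs; []; _∷_)
import Data.List.Relation.Unary.AllPairs.Properties as AllPairs
open import Data.List.Relation.Unary.Any as Any using (Any; here; there; _─_; any?)
open import Data.Maybe using (Maybe; just; nothing)
open import Data.Nat as ℕ using (zero; suc; _∸_; _≤_; _<_; z≤n; s≤s; _≤?_)
open import Data.Nat.DivMod using (%-distribˡ-*; m*n%n≡0)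
open import Data.Nat.Induction using (<-rec)
import Data.Nat.Properties as ℕ
open import Data.Product using (Σ; ∃; _,_; proj₁; proj₂)
open import Data.Sum as Sum using (_⊎_; inj₁; inj₂)
open import Data.Unit using (⊤)
open import Function using (_∘_; id)
open import Level using (_⊔_)
open import Relation.Binary.Bundles using (Setoid)
open import Relation.Binary.Core using (Rel)
open import Relation.Binary.Definitions using (Symmetric)
import Relation.Binary.PropositionalEquality as ≡
import Relation.Binary.Reasoning.Setoid as SetoidReasoning
open import Relation.Binary.Structures using (IsEquivalence)
open import Relation.Nullary using (Dec; yes; no; contradiction)
import Relation.Nullary.Decidable as Dec
open import Relation.Nullary.Decidable using (_×-dec_)
open import Relation.Unary using (Decidable)

-- The ring solver of the standard library needs a coefficient ring with
-- decidable equality; for an arbitrary commutative ring we take formal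
-- differences of naturals, kept in the normal form (a ∸ b , b ∸ a).
module IntegerCoefficientSolver {c ℓ} (R : CommutativeRing c ℓ) where
  open CommutativeRing R
  open import Algebra.Properties.Semiring.Mult semiring using (×-homo-+; ×1-homo-*; ×-congˡ) renaming (_×_ to _×ᵣ_)
  open import Algebra.Properties.Ring ring using (-‿distribʳ-*; -‿distribˡ-*; -‿involutive; -0#≈0#)
  open import Algebra.Properties.AbelianGroup +-abelianGroup using (⁻¹-∙-comm)
  open import Algebra.Properties.CommutativeSemigroup +-commutativeSemigroup using (interchange)
  open import Relation.Binary.Reasoning.Setoid setoid

  ι : ℕ → Carrier
  ι n = n ×ᵣ 1#

  Diff : Set
  Diff = ℕ × ℕ

  normalise : Diff → Diff
  normalise (a , b) = (a ∸ b , b ∸ a)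

  diffRing : RawRing _ _
  diffRing = record
    { Carrier = Diff
    ; _≈_ = _≡_
    ; _+_ = λ { (a , b) (c , d) → normalise (a ℕ.+ c , b ℕ.+ d) }
    ; _*_ = λ { (a , b) (c , d) → normalise (a ℕ.* c ℕ.+ b ℕ.* d , a ℕ.* d ℕ.+ b ℕ.* c) }
    ; -_ = λ { (a , b) → (b , a) }
    ; 0# = (0 , 0)
    ; 1# = (1 , 0)
    }

  ⟦_⟧ᴰ : Diff → Carrier
  ⟦ a , b ⟧ᴰ = ι a - ι b

  sub-+-sub : ∀ w x y z → (w - x) + (y - z) ≈ (w + y) - (x + z)
  sub-+-sub w x y z = trans (interchange w (- x) y (- z)) (+-congˡ (⁻¹-∙-comm x z))

  sub-*-sub : ∀ w x y z → (w * y + x * z) - (w * z + x * y) ≈ (w - x) * (y - z)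
  sub-*-sub w x y z = sym (begin
    (w - x) * (y - z)              ≈⟨ distribʳ (y - z) w (- x) ⟩
    w * (y - z) + (- x) * (y - z)  ≈⟨ +-cong (distribˡ w y (- z)) (distribˡ (- x) y (- z)) ⟩
    (w * y + w * (- z)) + ((- x) * y + (- x) * (- z))
      ≈⟨ +-cong (+-congˡ (sym (-‿distribʳ-* w z)))
                (+-cong (sym (-‿distribˡ-* x y))
                        (trans (sym (-‿distribˡ-* x (- z))) (trans (-‿cong (sym (-‿distribʳ-* x z))) (-‿involutive _)))) ⟩
    (w * y - w * z) + (- (x * y) + x * z)  ≈⟨ +-congˡ (+-comm _ _) ⟩
    (w * y - w * z) + (x * z - x * y)      ≈⟨ sub-+-sub _ _ _ _ ⟩
    (w * y + x * z) - (w * z + x * y)           ∎)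

  ⟦normalise⟧ : ∀ a b → ⟦ normalise (a , b) ⟧ᴰ ≈ ⟦ a , b ⟧ᴰ
  ⟦normalise⟧ zero    zero    = refl
  ⟦normalise⟧ zero    (suc b) = refl
  ⟦normalise⟧ (suc a) zero    = refl
  ⟦normalise⟧ (suc a) (suc b) = begin
    ⟦ normalise (a , b) ⟧ᴰ   ≈⟨ ⟦normalise⟧ a b ⟩
    ι a - ι b                ≈⟨ +-identityˡ _ ⟨
    0# + (ι a - ι b)         ≈⟨ +-congʳ (-‿inverseʳ 1#) ⟨
    (1# - 1#) + (ι a - ι b)  ≈⟨ sub-+-sub 1# 1# (ι a) (ι b) ⟩
    (1# + ι a) - (1# + ι b)  ∎

  ⟦⟧-homomorphism : diffRing -Raw-AlmostCommutative⟶ fromCommutativeRing R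
  ⟦⟧-homomorphism = record
    { ⟦_⟧ = ⟦_⟧ᴰ
    ; +-homo = λ { (a , b) (c , d) → begin
        ⟦ normalise (a ℕ.+ c , b ℕ.+ d) ⟧ᴰ  ≈⟨ ⟦normalise⟧ (a ℕ.+ c) (b ℕ.+ d) ⟩
        ι (a ℕ.+ c) - ι (b ℕ.+ d)           ≈⟨ +-cong (×-homo-+ 1# a c) (-‿cong (×-homo-+ 1# b d)) ⟩
        (ι a + ι c) - (ι b + ι d)           ≈⟨ sub-+-sub _ _ _ _ ⟨
        ⟦ a , b ⟧ᴰ + ⟦ c , d ⟧ᴰ                    ∎ }
    ; *-homo = λ { (a , b) (c , d) → begin
        ⟦ normalise (a ℕ.* c ℕ.+ b ℕ.* d , a ℕ.* d ℕ.+ b ℕ.* c) ⟧ᴰ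
          ≈⟨ ⟦normalise⟧ (a ℕ.* c ℕ.+ b ℕ.* d) (a ℕ.* d ℕ.+ b ℕ.* c) ⟩
        ι (a ℕ.* c ℕ.+ b ℕ.* d) - ι (a ℕ.* d ℕ.+ b ℕ.* c)
          ≈⟨ +-cong (ι-sum-of-products a c b d) (-‿cong (ι-sum-of-products a d b c)) ⟩
        (ι a * ι c + ι b * ι d) - (ι a * ι d + ι b * ι c)
          ≈⟨ sub-*-sub _ _ _ _ ⟩
        ⟦ a , b ⟧ᴰ * ⟦ c , d ⟧ᴰ
          ∎ }
    ; -‿homo = λ { (a , b) → begin
        ι b - ι a          ≈⟨ +-congʳ (-‿involutive _) ⟨
        - - (ι b) - ι a    ≈⟨ ⁻¹-∙-comm (- (ι b)) (ι a) ⟩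
        - (- (ι b) + ι a)  ≈⟨ -‿cong (+-comm _ _) ⟩
        - ⟦ a , b ⟧ᴰ               ∎ }
    ; 0-homo = -‿inverseʳ 0#
    ; 1-homo = trans (+-cong (+-identityʳ 1#) -0#≈0#) (+-identityʳ 1#)
    }
    where
    ι-sum-of-products : ∀ a c b d → ι (a ℕ.* c ℕ.+ b ℕ.* d) ≈ ι a * ι c + ι b * ι d
    ι-sum-of-products a c b d = trans (×-homo-+ 1# (a ℕ.* c) (b ℕ.* d)) (+-cong (×1-homo-* a c) (×1-homo-* b d))

  _≟ᴰ_ : ∀ x y → Maybe (Induced-equivalence ⟦⟧-homomorphism x y)
  (a , b) ≟ᴰ (c , d) with a ℕ.+ d ℕ.≟ b ℕ.+ c
  ... | no _  = nothing
  ... | yes e = just (begin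
    ι a - ι b                  ≈⟨ +-identityʳ _ ⟨
    (ι a - ι b) + 0#           ≈⟨ +-congˡ (-‿inverseʳ (ι d)) ⟨
    (ι a - ι b) + (ι d - ι d)  ≈⟨ sub-+-sub _ _ _ _ ⟩
    (ι a + ι d) - (ι b + ι d)  ≈⟨ +-congʳ (trans (sym (×-homo-+ 1# a d)) (trans (×-congˡ e) (×-homo-+ 1# b c))) ⟩
    (ι b + ι c) - (ι b + ι d)  ≈⟨ +-cong (+-comm _ _) (-‿cong (+-comm _ _)) ⟩
    (ι c + ι b) - (ι d + ι b)  ≈⟨ sub-+-sub _ _ _ _ ⟨
    (ι c - ι d) + (ι b - ι b)  ≈⟨ +-congˡ (-‿inverseʳ (ι b)) ⟩
    (ι c - ι d) + 0#           ≈⟨ +-identityʳ _ ⟩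
    ι c - ι d                              ∎)

  open import Algebra.Solver.Ring diffRing (fromCommutativeRing R) ⟦⟧-homomorphism _≟ᴰ_ public
    using (solve; con; _:+_; _:*_; _:-_; :-_; _:=_)

module _ {a} {A : Set a} where

  length-─ : ∀ {y} (xs : List A) (p : y ∈ xs) → length xs ≡ suc (length (xs ─ p))
  length-─ (x ∷ xs) (here _)  = ≡.refl
  length-─ (x ∷ xs) (there p) = ≡.cong suc (length-─ xs p)

  AllPairs-─ : ∀ {q} {Q : Rel A q} {y} (xs : List A) (p : y ∈ xs) → AllPairs Q xs → AllPairs Q (xs ─ p)
  AllPairs-─ (x ∷ xs) (here _)  (_ ∷ qs)  = qs
  AllPairs-─ (x ∷ xs) (there p) (qx ∷ qs) = All.─⁺ p qx ∷ AllPairs-─ xs p qs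

  AllPairs-─-removed : ∀ {q} {Q : Rel A q} → Symmetric Q → ∀ {y} (xs : List A) (p : y ∈ xs)
                     → AllPairs Q xs → All (Q y) (xs ─ p)
  AllPairs-─-removed Q-sym (x ∷ xs) (here ≡.refl) (qx ∷ _)  = qx
  AllPairs-─-removed Q-sym (x ∷ xs) (there p)   (qx ∷ qs) = Q-sym (All.lookup qx p) ∷ AllPairs-─-removed Q-sym xs p qs

  Any-─ : ∀ {q} {Q : A → Set q} {y} (xs : List A) (p : y ∈ xs) → Any Q xs → Q y ⊎ Any Q (xs ─ p)
  Any-─ (x ∷ xs) (here ≡.refl) (here qx) = inj₁ qx
  Any-─ (x ∷ xs) (here ≡.refl) (there a) = inj₂ a
  Any-─ (x ∷ xs) (there p)   (here qx) = inj₂ (here qx)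
  Any-─ (x ∷ xs) (there p)   (there a) = Sum.map₂ there (Any-─ xs p a)

  filter-─ : ∀ {q} {Q : A → Set q} (Q? : Decidable Q) {y} (xs : List A) (p : y ∈ xs) → ¬ Q y
           → filter Q? (xs ─ p) ≡ filter Q? xs
  filter-─ Q? (x ∷ xs) (here ≡.refl) ¬Qy = ≡.sym (filter-reject Q? ¬Qy)
  filter-─ Q? (x ∷ xs) (there p)   ¬Qy with Q? x
  ... | yes _ = ≡.cong (x ∷_) (filter-─ Q? xs p ¬Qy)
  ... | no  _ = filter-─ Q? xs p ¬Qy

  Any-filter⁺ : ∀ {q s} {Q : A → Set q} {S : A → Set s} (Q? : Decidable Q) {xs : List A}
              → (∀ {x} → S x → Q x) → Any S xs → Any S (filter Q? xs)
  Any-filter⁺ Q? {x ∷ xs} S⇒Q (here sx) with Q? x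
  ... | yes _  = here sx
  ... | no ¬qx = contradiction (S⇒Q sx) ¬qx
  Any-filter⁺ Q? {x ∷ xs} S⇒Q (there a) with Q? x
  ... | yes _ = there (Any-filter⁺ Q? S⇒Q a)
  ... | no _  = Any-filter⁺ Q? S⇒Q a

module InvolutionProducts {m ℓ} (M : CommutativeMonoid m ℓ) where
  open CommutativeMonoid M
  open import Algebra.Properties.CommutativeMonoid.Mult M public using (×-congʳ; ×-distrib-+) renaming (_×_ to _×ᵐ_)
  open import Algebra.Properties.CommutativeSemigroup commutativeSemigroup using (x∙yz≈y∙xz)
  open import Relation.Binary.Reasoning.Setoid setoid

  ∏ : List Carrier → Carrier
  ∏ = foldr _∙_ ε

  Distinct : List Carrier → Set _
  Distinct = AllPairs (λ a b → ¬ a ≈ b)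

  ×ᵐ-ε : ∀ k → k ×ᵐ ε ≈ ε
  ×ᵐ-ε zero    = refl
  ×ᵐ-ε (suc k) = trans (identityˡ _) (×ᵐ-ε k)

  ∏-─ : ∀ {y} xs (p : y ∈ xs) → ∏ xs ≈ y ∙ ∏ (xs ─ p)
  ∏-─ (x ∷ xs) (here ≡.refl) = refl
  ∏-─ {y} (x ∷ xs) (there p) = begin
    x ∙ ∏ xs              ≈⟨ ∙-congˡ (∏-─ xs p) ⟩
    x ∙ (y ∙ ∏ (xs ─ p))  ≈⟨ x∙yz≈y∙xz x y _ ⟩
    y ∙ (x ∙ ∏ (xs ─ p))  ∎

  ∏-oneClass : ∀ {b} xs → Distinct xs → All (_≈ b) xs → Any (b ≈_) xs → ∏ xs ≈ b
  ∏-oneClass (x ∷ [])     _                   (x≈b ∷ [])     _ = trans (identityʳ x) x≈b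
  ∏-oneClass (x ∷ y ∷ xs) ((x≉y ∷ _) ∷ _) (x≈b ∷ y≈b ∷ _) _ = contradiction (trans x≈b (sym y≈b)) x≉y

  private
    ∏-headClass : ∀ {a b x} xs → ¬ a ≈ b → x ≈ a → All (λ y → ¬ x ≈ y) xs → Distinct xs
                → All (λ y → y ≈ a ⊎ y ≈ b) xs → Any (b ≈_) (x ∷ xs) → ∏ (x ∷ xs) ≈ a ∙ b
    ∏-headClass {a} {b} {x} xs a≉b x≈a x∉xs dxs classes b∈ =
      ∙-cong x≈a (∏-oneClass xs dxs (All.zipWith only-b (classes , x∉xs)) (tail b∈))
      where
      only-b : ∀ {y} → (y ≈ a ⊎ y ≈ b) × ¬ x ≈ y → y ≈ b
      only-b (inj₁ y≈a , x≉y) = contradiction (trans x≈a (sym y≈a)) x≉y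
      only-b (inj₂ y≈b , _)   = y≈b
      tail : Any (b ≈_) (x ∷ xs) → Any (b ≈_) xs
      tail (here b≈x) = contradiction (sym (trans b≈x x≈a)) a≉b
      tail (there p)  = p

  ∏-twoClasses : ∀ {a b} xs → ¬ a ≈ b → Distinct xs → All (λ x → x ≈ a ⊎ x ≈ b) xs
               → Any (a ≈_) xs → Any (b ≈_) xs → ∏ xs ≈ a ∙ b
  ∏-twoClasses (x ∷ xs) a≉b (x∉xs ∷ dxs) (inj₁ x≈a ∷ classes) _  b∈ = ∏-headClass xs a≉b x≈a x∉xs dxs classes b∈
  ∏-twoClasses (x ∷ xs) a≉b (x∉xs ∷ dxs) (inj₂ x≈b ∷ classes) a∈ _ =
    trans (∏-headClass xs (a≉b ∘ sym) x≈b x∉xs dxs (All.map Sum.swap classes) a∈) (comm _ _)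

  module Pairing {r g} (R : Rel Carrier r) (Good : Carrier → Set g)
    (R-sym : Symmetric R) (R-functional : ∀ {x y z} → R x y → R x z → y ≈ z)
    (fixed? : Decidable (λ x → R x x))
    (c : Carrier) (R-∙ : ∀ {x y} → Good x → R x y → x ∙ y ≈ c) where

    record Paired (L F : List Carrier) : Set (m ⊔ ℓ) where
      field
        pairs   : ℕ
        length≡ : length L ≡ (pairs ℕ.+ pairs) ℕ.+ length F
        ∏≈      : ∏ L ≈ (pairs ×ᵐ c) ∙ ∏ F

    Closed : List Carrier → Set _
    Closed L = All (λ x → Any (R x) L) L

    closed-drop-fixed : ∀ {x L} → R x x → All (λ z → ¬ x ≈ z) L
                      → All (λ z → Any (R z) (x ∷ L)) L → Closed L
    closed-drop-fixed {x} {L} Rxx x∉L = All.zipWith partner-in-L ∘ (_, x∉L)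
      where
      partner-in-L : ∀ {z} → Any (R z) (x ∷ L) × ¬ x ≈ z → Any (R z) L
      partner-in-L (here Rzx , x≉z) = contradiction (R-functional Rxx (R-sym Rzx)) x≉z
      partner-in-L (there p  , _)   = p

    paired-fixed : ∀ {x L F} → Paired L F → Paired (x ∷ L) (x ∷ F)
    paired-fixed {x} paired = record
      { pairs   = pairs
      ; length≡ = ≡.trans (≡.cong suc length≡) (≡.sym (ℕ.+-suc (pairs ℕ.+ pairs) _))
      ; ∏≈      = trans (∙-congˡ ∏≈) (x∙yz≈y∙xz x _ _)
      }
      where open Paired paired

    closed-drop-pair : ∀ {x y L} (y∈L : y ∈ L) → R x y → All (λ z → ¬ x ≈ z) L → Distinct L
                     → All (λ z → Any (R z) (x ∷ L)) L → Closed (L ─ y∈L)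
    closed-drop-pair {x} {y} {L} y∈L Rxy x∉L dL pL = All.zipWith partner-in-L′
      (All.─⁺ y∈L (All.zip (pL , x∉L)) , AllPairs-─-removed (λ y≉z z≈y → y≉z (sym z≈y)) L y∈L dL)
      where
      partner-in-L′ : ∀ {z} → (Any (R z) (x ∷ L) × ¬ x ≈ z) × ¬ y ≈ z → Any (R z) (L ─ y∈L)
      partner-in-L′ ((here Rzx , _)   , y≉z) = contradiction (R-functional Rxy (R-sym Rzx)) y≉z
      partner-in-L′ ((there p  , x≉z) , _)   with Any-─ L y∈L p
      ... | inj₁ Rzy = contradiction (sym (R-functional (R-sym Rzy) (R-sym Rxy))) x≉z
      ... | inj₂ p′  = p′

    paired-pair : ∀ {x y L F} (y∈L : y ∈ L) → Good x → R x y → Paired (L ─ y∈L) F → Paired (x ∷ L) F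
    paired-pair {x} {y} {L} {F} y∈L gx Rxy paired = record
      { pairs   = suc pairs
      ; length≡ = ≡.trans (≡.cong suc (length-─ L y∈L))
                  (≡.trans (≡.cong (suc ∘ suc) length≡) (≡.cong (λ n → suc n ℕ.+ length F) (≡.sym (ℕ.+-suc pairs pairs))))
      ; ∏≈      = begin
          x ∙ ∏ L                   ≈⟨ ∙-congˡ (∏-─ L y∈L) ⟩
          x ∙ (y ∙ ∏ (L ─ y∈L))     ≈⟨ assoc x y _ ⟨
          (x ∙ y) ∙ ∏ (L ─ y∈L)     ≈⟨ ∙-cong (R-∙ gx Rxy) ∏≈ ⟩
          c ∙ ((pairs ×ᵐ c) ∙ ∏ F)  ≈⟨ assoc c _ _ ⟨
          (c ∙ (pairs ×ᵐ c)) ∙ ∏ F  ∎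
      }
      where open Paired paired

    -- Recursion on a bound n for the length, since dropping a pair is not structural.
    pairing′ : ∀ n L → length L ℕ.≤ n → Distinct L → All Good L → Closed L → Paired L (filter fixed? L)
    pairing′ n [] _ _ _ _ = record { pairs = 0 ; length≡ = ≡.refl ; ∏≈ = sym (identityˡ ε) }
    pairing′ (suc n) (x ∷ L) (s≤s len≤n) (x∉L ∷ dL) (gx ∷ gL) (px ∷ pL) with fixed? x
    ... | yes Rxx = paired-fixed (pairing′ n L len≤n dL gL (closed-drop-fixed Rxx x∉L pL))
    ... | no ¬Rxx with find (partner px)
      where
      partner : Any (R x) (x ∷ L) → Any (R x) L
      partner (here Rxx) = contradiction Rxx ¬Rxx
      partner (there p)  = p
    ...   | y , y∈L , Rxy = paired-pair y∈L gx Rxy (≡.subst (Paired (L ─ y∈L)) (filter-─ fixed? L y∈L ¬Ryy)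
      (pairing′ n (L ─ y∈L) len≤n′ (AllPairs-─ L y∈L dL) (All.─⁺ y∈L gL) (closed-drop-pair y∈L Rxy x∉L dL pL)))
      where
      ¬Ryy : ¬ R y y
      ¬Ryy Ryy = All.lookup x∉L y∈L (sym (R-functional Ryy (R-sym Rxy)))
      len≤n′ : length (L ─ y∈L) ℕ.≤ n
      len≤n′ = ℕ.≤-trans (ℕ.n≤1+n _) (≡.subst (ℕ._≤ n) (length-─ L y∈L) len≤n)

    pairing : ∀ L → Distinct L → All Good L → Closed L → Paired L (filter fixed? L)
    pairing L = pairing′ (length L) L ℕ.≤-refl

    pairing-fixedPointFree : ∀ L → Distinct L → All Good L → Closed L → All (λ x → ¬ R x x) L
                           → Σ ℕ λ k → length L ≡ k ℕ.+ k × ∏ L ≈ k ×ᵐ c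
    pairing-fixedPointFree L dL gL cL ¬fixed =
      pairs ,
      ≡.trans length≡ (ℕ.+-identityʳ _) ,
      trans ∏≈ (identityʳ _)
      where open Paired (≡.subst (Paired L) (filter-none fixed? ¬fixed) (pairing L dL gL cL))

module FieldFacts (F : FiniteField) where
  open FiniteField F

  fieldRing : CommutativeRing _ _
  fieldRing = record { isCommutativeRing = isCommutativeRing }

  open CommutativeRing fieldRing public
    using (+-assoc; +-comm; +-identityˡ; +-identityʳ; -‿inverseˡ; -‿inverseʳ;
           *-assoc; *-comm; *-identityˡ; *-identityʳ; distribˡ; distribʳ; zeroˡ; zeroʳ)
  open import Algebra.Properties.Ring (CommutativeRing.ring fieldRing) public using (-0#≈0#)
  open import Algebra.Properties.CommutativeSemigroup (CommutativeRing.+-commutativeSemigroup fieldRing) public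
    using () renaming (interchange to +-interchange)

  1≢0 : ¬ 1# ≡ 0#
  1≢0 = 0≢1 ∘ ≡.sym

  *-nonzero : ∀ {a b} → ¬ a ≡ 0# → ¬ b ≡ 0# → ¬ (a * b) ≡ 0#
  *-nonzero {a} {b} a≢0 b≢0 ab≡0 with inverse a a≢0
  ... | a⁻¹ , aa⁻¹≡1 = b≢0 (begin
    b                ≡⟨ *-identityˡ b ⟨
    1# * b         ≡⟨ ≡.cong (_* b) (≡.trans (≡.sym aa⁻¹≡1) (*-comm a a⁻¹)) ⟩
    (a⁻¹ * a) * b  ≡⟨ *-assoc a⁻¹ a b ⟩
    a⁻¹ * (a * b)  ≡⟨ ≡.cong (a⁻¹ *_) ab≡0 ⟩
    a⁻¹ * 0#       ≡⟨ zeroʳ a⁻¹ ⟩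
    0#               ∎)
    where open ≡.≡-Reasoning

  -- In characteristic 2, x ↦ x + 1 is a fixed-point-free involution of the field.
  odd-size⇒1+1≢0 : size % 2 ≡ 1 → ¬ (1# + 1#) ≡ 0#
  odd-size⇒1+1≢0 odd 1+1≡0 = ℕ.0≢1+n (≡.trans (≡.sym (≡.trans (≡.cong (_% 2) size≡k+k) (even k))) odd)
    where
    x+x≡0 : ∀ x → x + x ≡ 0#
    x+x≡0 x = begin
      x + x                ≡⟨ ≡.cong₂ _+_ (*-identityˡ x) (*-identityˡ x) ⟨
      (1# * x) + (1# * x)  ≡⟨ distribʳ x 1# 1# ⟨
      (1# + 1#) * x        ≡⟨ ≡.cong (_* x) 1+1≡0 ⟩
      0# * x               ≡⟨ zeroˡ x ⟩
      0#                   ∎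
      where open ≡.≡-Reasoning
    x+1+1≡x : ∀ x → (x + 1#) + 1# ≡ x
    x+1+1≡x x = ≡.trans (+-assoc x 1# 1#) (≡.trans (≡.cong (x +_) 1+1≡0) (+-identityʳ x))
    x+[x+1]≡1 : ∀ x → x + (x + 1#) ≡ 1#
    x+[x+1]≡1 x = ≡.trans (≡.sym (+-assoc x x 1#)) (≡.trans (≡.cong (_+ 1#) (x+x≡0 x)) (+-identityˡ 1#))
    open InvolutionProducts (CommutativeRing.+-commutativeMonoid fieldRing)
    Succ : Rel Carrier _
    Succ x y = y ≡ x + 1#
    succ-sym : Symmetric Succ
    succ-sym {x} ≡.refl = ≡.sym (x+1+1≡x x)
    succ-functional : ∀ {x y z} → Succ x y → Succ x z → y ≡ z
    succ-functional ≡.refl ≡.refl = ≡.refl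
    succ-∙ : ∀ {x y} → ⊤ → Succ x y → x + y ≡ 1#
    succ-∙ {x} _ ≡.refl = x+[x+1]≡1 x
    open Pairing Succ (λ _ → ⊤) succ-sym succ-functional (λ x → x ≟ (x + 1#)) 1# succ-∙
    no-fixed-point : ∀ x → ¬ Succ x x
    no-fixed-point x x≡x+1 = 0≢1 (begin
      0#            ≡⟨ x+x≡0 x ⟨
      x + x         ≡⟨ ≡.cong (x +_) x≡x+1 ⟩
      x + (x + 1#)  ≡⟨ x+[x+1]≡1 x ⟩
      1#               ∎)
      where open ≡.≡-Reasoning
    pairedElements = pairing-fixedPointFree elements elements-unique (All.tabulate _)
      (All.tabulate (λ {x} _ → Any.map ≡.sym (elements-complete (x + 1#))))
      (All.tabulate (λ {x} _ → no-fixed-point x))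
    k = proj₁ pairedElements
    size≡k+k : size ≡ k ℕ.+ k
    size≡k+k = proj₁ (proj₂ pairedElements)
    even : ∀ k → (k ℕ.+ k) % 2 ≡ 0
    even k = ≡.trans (≡.cong (_% 2) (≡.trans (≡.cong (k ℕ.+_) (≡.sym (ℕ.+-identityʳ k))) (ℕ.*-comm 2 k))) (m*n%n≡0 k 2)

module Polynomials (F : FiniteField) where
  open FiniteField F
  open FieldFacts F
  open Poly F

  infix 4 _≋_

  -- Defs' _≈_ unfolds to a function type from which Agda cannot infer the
  -- two polynomials; wrapping it in a record restores inference.
  record _≋_ (p q : Pol) : Set where
    constructor ⟪_⟫
    field coeff≡ : p ≈ q
  open _≋_ public

  ≋-refl : ∀ {p} → p ≋ p
  ≋-refl = ⟪ (λ _ → ≡.refl) ⟫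

  ≋-sym : ∀ {p q} → p ≋ q → q ≋ p
  ≋-sym ⟪ e ⟫ = ⟪ (λ n → ≡.sym (e n)) ⟫

  ≋-trans : ∀ {p q r} → p ≋ q → q ≋ r → p ≋ r
  ≋-trans ⟪ e ⟫ ⟪ e′ ⟫ = ⟪ (λ n → ≡.trans (e n) (e′ n)) ⟫

  ≋-isEquivalence : IsEquivalence _≋_
  ≋-isEquivalence = record { refl = ≋-refl ; sym = ≋-sym ; trans = ≋-trans }

  ≋-setoid : Setoid _ _
  ≋-setoid = record { isEquivalence = ≋-isEquivalence }

  _·_ : Carrier → Pol → Pol
  a · p = map (a *_) p

  shift : Pol → Pol
  shift p = 0# ∷ p

  coeff-⊕ : ∀ p q n → coeff (p ⊕ q) n ≡ coeff p n + coeff q n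
  coeff-⊕ []      q       n       = ≡.sym (+-identityˡ _)
  coeff-⊕ (a ∷ p) []      zero    = ≡.sym (+-identityʳ _)
  coeff-⊕ (a ∷ p) []      (suc n) = ≡.sym (+-identityʳ _)
  coeff-⊕ (a ∷ p) (b ∷ q) zero    = ≡.refl
  coeff-⊕ (a ∷ p) (b ∷ q) (suc n) = coeff-⊕ p q n

  coeff-negP : ∀ p n → coeff (negP p) n ≡ - coeff p n
  coeff-negP []      n       = ≡.sym -0#≈0#
  coeff-negP (a ∷ p) zero    = ≡.refl
  coeff-negP (a ∷ p) (suc n) = coeff-negP p n

  coeff-· : ∀ a p n → coeff (a · p) n ≡ a * coeff p n
  coeff-· a []      n       = ≡.sym (zeroʳ a)
  coeff-· a (b ∷ p) zero    = ≡.refl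
  coeff-· a (b ∷ p) (suc n) = coeff-· a p n

  ∷-cong : ∀ {a b p q} → a ≡ b → p ≋ q → (a ∷ p) ≋ (b ∷ q)
  ∷-cong a≡b ⟪ e ⟫ = ⟪ (λ { zero → a≡b ; (suc n) → e n }) ⟫

  ⊕-cong : ∀ {p p′ q q′} → p ≋ p′ → q ≋ q′ → (p ⊕ q) ≋ (p′ ⊕ q′)
  ⊕-cong {p} {p′} {q} {q′} ⟪ e ⟫ ⟪ f ⟫ = ⟪ (λ n → begin
    coeff (p ⊕ q) n          ≡⟨ coeff-⊕ p q n ⟩
    coeff p n + coeff q n    ≡⟨ ≡.cong₂ _+_ (e n) (f n) ⟩
    coeff p′ n + coeff q′ n  ≡⟨ ≡.sym (coeff-⊕ p′ q′ n) ⟩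
    coeff (p′ ⊕ q′) n ∎) ⟫
    where open ≡.≡-Reasoning

  negP-cong : ∀ {p q} → p ≋ q → negP p ≋ negP q
  negP-cong {p} {q} ⟪ e ⟫ = ⟪ (λ n → ≡.trans (coeff-negP p n) (≡.trans (≡.cong -_ (e n)) (≡.sym (coeff-negP q n)))) ⟫

  ·-cong : ∀ {a b p q} → a ≡ b → p ≋ q → (a · p) ≋ (b · q)
  ·-cong {a} {b} {p} {q} e ⟪ f ⟫ = ⟪ (λ n → ≡.trans (coeff-· a p n) (≡.trans (≡.cong₂ _*_ e (f n)) (≡.sym (coeff-· b q n)))) ⟫

  ⊕-assoc : ∀ p q r → ((p ⊕ q) ⊕ r) ≋ (p ⊕ (q ⊕ r))
  ⊕-assoc p q r = ⟪ (λ n → begin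
    coeff ((p ⊕ q) ⊕ r) n                ≡⟨ coeff-⊕ (p ⊕ q) r n ⟩
    coeff (p ⊕ q) n + coeff r n          ≡⟨ ≡.cong (_+ coeff r n) (coeff-⊕ p q n) ⟩
    (coeff p n + coeff q n) + coeff r n  ≡⟨ +-assoc _ _ _ ⟩
    coeff p n + (coeff q n + coeff r n)  ≡⟨ ≡.cong (coeff p n +_) (≡.sym (coeff-⊕ q r n)) ⟩
    coeff p n + coeff (q ⊕ r) n          ≡⟨ ≡.sym (coeff-⊕ p (q ⊕ r) n) ⟩
    coeff (p ⊕ (q ⊕ r)) n ∎) ⟫
    where open ≡.≡-Reasoning

  ⊕-comm : ∀ p q → (p ⊕ q) ≋ (q ⊕ p)
  ⊕-comm p q = ⟪ (λ n → ≡.trans (coeff-⊕ p q n) (≡.trans (+-comm _ _) (≡.sym (coeff-⊕ q p n)))) ⟫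

  ⊕-identityˡ : ∀ p → ([] ⊕ p) ≋ p
  ⊕-identityˡ p = ≋-refl

  ⊕-identityʳ : ∀ p → (p ⊕ []) ≋ p
  ⊕-identityʳ p = ⟪ (λ n → ≡.trans (coeff-⊕ p [] n) (+-identityʳ _)) ⟫

  ⊕-inverseˡ : ∀ p → (negP p ⊕ p) ≋ []
  ⊕-inverseˡ p = ⟪ (λ n → ≡.trans (coeff-⊕ (negP p) p n) (≡.trans (≡.cong (_+ coeff p n) (coeff-negP p n)) (-‿inverseˡ _))) ⟫

  ⊕-inverseʳ : ∀ p → (p ⊕ negP p) ≋ []
  ⊕-inverseʳ p = ≋-trans (⊕-comm p (negP p)) (⊕-inverseˡ p)

  ·-distrib-+ : ∀ a b p → ((a + b) · p) ≋ ((a · p) ⊕ (b · p))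
  ·-distrib-+ a b p = ⟪ (λ n → begin
    coeff ((a + b) · p) n              ≡⟨ coeff-· (a + b) p n ⟩
    (a + b) * coeff p n                ≡⟨ distribʳ _ _ _ ⟩
    (a * coeff p n) + (b * coeff p n)  ≡⟨ ≡.sym (≡.cong₂ _+_ (coeff-· a p n) (coeff-· b p n)) ⟩
    coeff (a · p) n + coeff (b · p) n  ≡⟨ ≡.sym (coeff-⊕ (a · p) (b · p) n) ⟩
    coeff ((a · p) ⊕ (b · p)) n ∎) ⟫
    where open ≡.≡-Reasoning

  ·-distrib-⊕ : ∀ a p q → (a · (p ⊕ q)) ≋ ((a · p) ⊕ (a · q))
  ·-distrib-⊕ a p q = ⟪ (λ n → begin
    coeff (a · (p ⊕ q)) n              ≡⟨ coeff-· a (p ⊕ q) n ⟩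
    a * coeff (p ⊕ q) n                ≡⟨ ≡.cong (a *_) (coeff-⊕ p q n) ⟩
    a * (coeff p n + coeff q n)        ≡⟨ distribˡ _ _ _ ⟩
    (a * coeff p n) + (a * coeff q n)  ≡⟨ ≡.sym (≡.cong₂ _+_ (coeff-· a p n) (coeff-· a q n)) ⟩
    coeff (a · p) n + coeff (a · q) n  ≡⟨ ≡.sym (coeff-⊕ (a · p) (a · q) n) ⟩
    coeff ((a · p) ⊕ (a · q)) n ∎) ⟫
    where open ≡.≡-Reasoning

  ·-assoc : ∀ a b p → (a · (b · p)) ≋ ((a * b) · p)
  ·-assoc a b p = ⟪ (λ n → begin
    coeff (a · (b · p)) n  ≡⟨ coeff-· a (b · p) n ⟩
    a * coeff (b · p) n    ≡⟨ ≡.cong (a *_) (coeff-· b p n) ⟩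
    a * (b * coeff p n)    ≡⟨ ≡.sym (*-assoc _ _ _) ⟩
    (a * b) * coeff p n    ≡⟨ ≡.sym (coeff-· (a * b) p n) ⟩
    coeff ((a * b) · p) n ∎) ⟫
    where open ≡.≡-Reasoning

  ·-one : ∀ p → (1# · p) ≋ p
  ·-one p = ⟪ (λ n → ≡.trans (coeff-· 1# p n) (*-identityˡ _)) ⟫

  ·-zero : ∀ p → (0# · p) ≋ []
  ·-zero p = ⟪ (λ n → ≡.trans (coeff-· 0# p n) (zeroˡ _)) ⟫

  shift-⊕ : ∀ p q → shift (p ⊕ q) ≋ (shift p ⊕ shift q)
  shift-⊕ p q = ⟪ (λ { zero → ≡.sym (+-identityʳ 0#) ; (suc n) → ≡.refl }) ⟫

  shift-zero : ∀ {p} → p ≋ [] → shift p ≋ []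
  shift-zero ⟪ e ⟫ = ⟪ (λ { zero → ≡.refl ; (suc n) → e n }) ⟫

  ⊕-interchange : ∀ x y z w → ((x ⊕ y) ⊕ (z ⊕ w)) ≋ ((x ⊕ z) ⊕ (y ⊕ w))
  ⊕-interchange x y z w = ⟪ (λ n → begin
    coeff ((x ⊕ y) ⊕ (z ⊕ w)) n                        ≡⟨ ≡.trans (coeff-⊕ (x ⊕ y) (z ⊕ w) n) (≡.cong₂ _+_ (coeff-⊕ x y n) (coeff-⊕ z w n)) ⟩
    (coeff x n + coeff y n) + (coeff z n + coeff w n)  ≡⟨ +-interchange _ _ _ _ ⟩
    (coeff x n + coeff z n) + (coeff y n + coeff w n)  ≡⟨ ≡.sym (≡.trans (coeff-⊕ (x ⊕ z) (y ⊕ w) n) (≡.cong₂ _+_ (coeff-⊕ x z n) (coeff-⊕ y w n))) ⟩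
    coeff ((x ⊕ z) ⊕ (y ⊕ w)) n ∎) ⟫
    where open ≡.≡-Reasoning

  ⊗-zeroʳ : ∀ p → (p ⊗ []) ≋ []
  ⊗-zeroʳ [] = ≋-refl
  ⊗-zeroʳ (a ∷ p) = shift-zero (⊗-zeroʳ p)

  ⊗-zeroˡ : ∀ {p} q → p ≋ [] → (p ⊗ q) ≋ []
  ⊗-zeroˡ {[]} q e = ≋-refl
  ⊗-zeroˡ {a ∷ p} q ⟪ e ⟫ = ⊕-cong (≋-trans (·-cong (e 0) ≋-refl) (·-zero q)) (shift-zero (⊗-zeroˡ {p} q ⟪ (λ n → e (suc n)) ⟫))

  ⊗-congˡ : ∀ {p p′} q → p ≋ p′ → (p ⊗ q) ≋ (p′ ⊗ q)
  ⊗-congˡ {[]} {p′} q e = ≋-sym (⊗-zeroˡ q (≋-sym e))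
  ⊗-congˡ {a ∷ p} {[]} q e = ⊗-zeroˡ q e
  ⊗-congˡ {a ∷ p} {b ∷ p′} q ⟪ e ⟫ = ⊕-cong (·-cong (e 0) ≋-refl) (∷-cong ≡.refl (⊗-congˡ {p} {p′} q ⟪ (λ n → e (suc n)) ⟫))

  ⊗-distribʳ : ∀ p p′ q → ((p ⊕ p′) ⊗ q) ≋ ((p ⊗ q) ⊕ (p′ ⊗ q))
  ⊗-distribʳ [] p′ q = ≋-refl
  ⊗-distribʳ (a ∷ p) [] q = ≋-sym (⊕-identityʳ _)
  ⊗-distribʳ (a ∷ p) (b ∷ p′) q = begin
    (((a + b) · q) ⊕ shift ((p ⊕ p′) ⊗ q))                    ≈⟨ ⊕-cong (·-distrib-+ a b q) (∷-cong ≡.refl (⊗-distribʳ p p′ q)) ⟩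
    (((a · q) ⊕ (b · q)) ⊕ shift ((p ⊗ q) ⊕ (p′ ⊗ q)))        ≈⟨ ⊕-cong ≋-refl (shift-⊕ (p ⊗ q) (p′ ⊗ q)) ⟩
    (((a · q) ⊕ (b · q)) ⊕ (shift (p ⊗ q) ⊕ shift (p′ ⊗ q)))  ≈⟨ ⊕-interchange (a · q) (b · q) (shift (p ⊗ q)) (shift (p′ ⊗ q)) ⟩
    (((a · q) ⊕ shift (p ⊗ q)) ⊕ ((b · q) ⊕ shift (p′ ⊗ q))) ∎
    where open SetoidReasoning ≋-setoid

  ·-shift : ∀ a s → (a · shift s) ≋ shift (a · s)
  ·-shift a s = ∷-cong (zeroʳ a) ≋-refl

  shift-⊗ : ∀ p q → (shift p ⊗ q) ≋ shift (p ⊗ q)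
  shift-⊗ p q = ⊕-cong (·-zero q) ≋-refl

  ·-⊗-assoc : ∀ a q r → ((a · q) ⊗ r) ≋ (a · (q ⊗ r))
  ·-⊗-assoc a [] r = ≋-refl
  ·-⊗-assoc a (b ∷ q) r = begin
    (((a * b) · r) ⊕ shift ((a · q) ⊗ r))  ≈⟨ ⊕-cong ≋-refl (∷-cong ≡.refl (·-⊗-assoc a q r)) ⟩
    (((a * b) · r) ⊕ shift (a · (q ⊗ r)))  ≈⟨ ⊕-cong (·-assoc a b r) (·-shift a (q ⊗ r)) ⟨
    ((a · (b · r)) ⊕ (a · shift (q ⊗ r)))  ≈⟨ ·-distrib-⊕ a (b · r) (shift (q ⊗ r)) ⟨
    (a · ((b · r) ⊕ shift (q ⊗ r))) ∎
    where open SetoidReasoning ≋-setoid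

  ⊕-swap : ∀ x y z → (x ⊕ (y ⊕ z)) ≋ (y ⊕ (x ⊕ z))
  ⊕-swap x y z = ≋-trans (≋-sym (⊕-assoc x y z)) (≋-trans (⊕-cong (⊕-comm x y) ≋-refl) (⊕-assoc y x z))

  ⊗-∷ : ∀ q a p → (q ⊗ (a ∷ p)) ≋ ((a · q) ⊕ shift (q ⊗ p))
  ⊗-∷ [] a p = ≋-sym (shift-zero ≋-refl)
  ⊗-∷ (b ∷ q) a p = begin
    (((b * a) ∷ (b · p)) ⊕ shift (q ⊗ (a ∷ p)))              ≈⟨ ⊕-cong (≋-refl {(b * a) ∷ (b · p)}) (∷-cong ≡.refl (⊗-∷ q a p)) ⟩
    (((b * a) ∷ (b · p)) ⊕ shift ((a · q) ⊕ shift (q ⊗ p)))  ≈⟨ ∷-cong (≡.cong (_+ 0#) (*-comm b a)) (⊕-swap (b · p) (a · q) (shift (q ⊗ p))) ⟩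
    (((a * b) ∷ (a · q)) ⊕ shift ((b · p) ⊕ shift (q ⊗ p))) ∎
    where open SetoidReasoning ≋-setoid

  ⊗-comm : ∀ p q → (p ⊗ q) ≋ (q ⊗ p)
  ⊗-comm [] q = ≋-sym (⊗-zeroʳ q)
  ⊗-comm (a ∷ p) q = ≋-trans (⊕-cong (≋-refl {a · q}) (∷-cong ≡.refl (⊗-comm p q))) (≋-sym (⊗-∷ q a p))

  ⊗-congʳ : ∀ p {q q′} → q ≋ q′ → (p ⊗ q) ≋ (p ⊗ q′)
  ⊗-congʳ p {q} {q′} e = ≋-trans (⊗-comm p q) (≋-trans (⊗-congˡ p e) (⊗-comm q′ p))

  ⊗-cong : ∀ {p p′ q q′} → p ≋ p′ → q ≋ q′ → (p ⊗ q) ≋ (p′ ⊗ q′)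
  ⊗-cong {p} {p′} {q} {q′} e f = ≋-trans (⊗-congˡ q e) (⊗-congʳ p′ f)

  ⊗-distribˡ : ∀ p q r → (p ⊗ (q ⊕ r)) ≋ ((p ⊗ q) ⊕ (p ⊗ r))
  ⊗-distribˡ p q r = ≋-trans (⊗-comm p (q ⊕ r)) (≋-trans (⊗-distribʳ q r p) (⊕-cong (⊗-comm q p) (⊗-comm r p)))

  ⊗-assoc : ∀ p q r → ((p ⊗ q) ⊗ r) ≋ (p ⊗ (q ⊗ r))
  ⊗-assoc [] q r = ≋-refl
  ⊗-assoc (a ∷ p) q r = begin
    (((a · q) ⊕ shift (p ⊗ q)) ⊗ r)        ≈⟨ ⊗-distribʳ (a · q) (shift (p ⊗ q)) r ⟩
    (((a · q) ⊗ r) ⊕ (shift (p ⊗ q) ⊗ r))  ≈⟨ ⊕-cong (·-⊗-assoc a q r) (shift-⊗ (p ⊗ q) r) ⟩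
    ((a · (q ⊗ r)) ⊕ shift ((p ⊗ q) ⊗ r))  ≈⟨ ⊕-cong (≋-refl {a · (q ⊗ r)}) (∷-cong ≡.refl (⊗-assoc p q r)) ⟩
    ((a · (q ⊗ r)) ⊕ shift (p ⊗ (q ⊗ r))) ∎
    where open SetoidReasoning ≋-setoid

  ⊗-identityˡ : ∀ q → (oneP ⊗ q) ≋ q
  ⊗-identityˡ q = ≋-trans (⊕-cong (·-one q) (shift-zero (≋-refl {[]}))) (⊕-identityʳ q)

  ⊗-identityʳ : ∀ q → (q ⊗ oneP) ≋ q
  ⊗-identityʳ q = ≋-trans (⊗-comm q oneP) (⊗-identityˡ q)

  polyRing : CommutativeRing _ _
  polyRing = record
    { Carrier = Pol
    ; _≈_ = _≋_
    ; _+_ = _⊕_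
    ; _*_ = _⊗_
    ; -_ = negP
    ; 0# = []
    ; 1# = oneP
    ; isCommutativeRing = record
      { isRing = record
        { +-isAbelianGroup = record
          { isGroup = record
            { isMonoid = record
              { isSemigroup = record
                { isMagma = record { isEquivalence = ≋-isEquivalence ; ∙-cong = ⊕-cong }
                ; assoc = ⊕-assoc }
              ; identity = ⊕-identityˡ , ⊕-identityʳ }
            ; inverse = ⊕-inverseˡ , ⊕-inverseʳ
            ; ⁻¹-cong = negP-cong }
          ; comm = ⊕-comm }
        ; *-cong = ⊗-cong
        ; *-assoc = ⊗-assoc
        ; *-identity = ⊗-identityˡ , ⊗-identityʳ
        ; distrib = ⊗-distribˡ , (λ x y z → ⊗-distribʳ y z x) }
      ; *-comm = ⊗-comm } }

  deg⁺ : Pol → ℕ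
  deg⁺ p = length (strip p)

  consN-≋ : ∀ a r → consN a r ≋ (a ∷ r)
  consN-≋ a [] with a ≟ 0#
  ... | yes a≡0 = ⟪ (λ { zero → ≡.sym a≡0 ; (suc n) → ≡.refl }) ⟫
  ... | no _ = ≋-refl
  consN-≋ a (b ∷ r) = ≋-refl

  strip-≋ : ∀ p → strip p ≋ p
  strip-≋ [] = ≋-refl
  strip-≋ (a ∷ p) = ≋-trans (consN-≋ a (strip p)) (∷-cong ≡.refl (strip-≋ p))

  ≋0⇒strip≡[] : ∀ p → p ≋ [] → strip p ≡ []
  ≋0⇒strip≡[] [] e = ≡.refl
  ≋0⇒strip≡[] (a ∷ p) ⟪ e ⟫ rewrite ≋0⇒strip≡[] p ⟪ (λ n → e (suc n)) ⟫ with a ≟ 0#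
  ... | yes _ = ≡.refl
  ... | no a≢0 = ⊥-elim (a≢0 (e 0))

  strip-cong : ∀ {p q} → p ≋ q → strip p ≡ strip q
  strip-cong {[]} {q} e = ≡.sym (≋0⇒strip≡[] q (≋-sym e))
  strip-cong {a ∷ p} {[]} e = ≋0⇒strip≡[] (a ∷ p) e
  strip-cong {a ∷ p} {b ∷ q} ⟪ e ⟫ = ≡.cong₂ consN (e 0) (strip-cong {p} {q} ⟪ (λ n → e (suc n)) ⟫)

  deg⁺-cong : ∀ {p q} → p ≋ q → deg⁺ p ≡ deg⁺ q
  deg⁺-cong e = ≡.cong length (strip-cong e)

  coeff-beyond-length : ∀ l n → length l ≤ n → coeff l n ≡ 0#
  coeff-beyond-length [] n _ = ≡.refl
  coeff-beyond-length (a ∷ l) (suc n) (s≤s le) = coeff-beyond-length l n le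

  record DegBelow (p : Pol) (n : ℕ) : Set where
    constructor degBelow
    field vanishes : ∀ m → n ≤ m → coeff p m ≡ 0#
  open DegBelow public

  DegBelow-deg⁺ : ∀ p → DegBelow p (deg⁺ p)
  DegBelow-deg⁺ p = degBelow λ m le → ≡.trans (≡.sym (coeff≡ (strip-≋ p) m)) (coeff-beyond-length (strip p) m le)

  LastNonzero : Pol → Set
  LastNonzero l = ∀ k → length l ≡ suc k → ¬ coeff l k ≡ 0#

  consN-LastNonzero : ∀ a r → LastNonzero r → LastNonzero (consN a r)
  consN-LastNonzero a [] nr with a ≟ 0#
  ... | yes _ = λ k ()
  ... | no a≢0 = λ { zero ≡.refl → a≢0 }
  consN-LastNonzero a (b ∷ r) nr = λ { (suc k) e → nr k (ℕ.suc-injective e) }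

  strip-LastNonzero : ∀ p → LastNonzero (strip p)
  strip-LastNonzero [] = λ k ()
  strip-LastNonzero (a ∷ p) = consN-LastNonzero a (strip p) (strip-LastNonzero p)

  leading≢0 : ∀ p k → deg⁺ p ≡ suc k → ¬ coeff p k ≡ 0#
  leading≢0 p k e c = strip-LastNonzero p k e (≡.trans (coeff≡ (strip-≋ p) k) c)

  DegBelow⇒deg⁺≤ : ∀ {p n} → DegBelow p n → deg⁺ p ≤ n
  DegBelow⇒deg⁺≤ {p} {n} (degBelow b) with deg⁺ p in eq
  ... | zero = z≤n
  ... | suc k with suc k ≤? n
  ...   | yes le = le
  ...   | no nle = ⊥-elim (leading≢0 p k eq (b k (ℕ.≤-pred (ℕ.≰⇒> nle))))

  deg⁺-exact : ∀ {p k} → DegBelow p (suc k) → ¬ coeff p k ≡ 0# → deg⁺ p ≡ suc k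
  deg⁺-exact {p} {k} b c with ℕ.m≤n⇒m<n∨m≡n (DegBelow⇒deg⁺≤ b)
  ... | inj₂ e = e
  ... | inj₁ (s≤s lt) = ⊥-elim (c (vanishes (DegBelow-deg⁺ p) k lt))

  deg⁺≡0⇒≋0 : ∀ {p} → deg⁺ p ≡ 0 → p ≋ []
  deg⁺≡0⇒≋0 {p} e = ⟪ (λ n → vanishes (DegBelow-deg⁺ p) n (≡.subst (_≤ n) (≡.sym e) z≤n)) ⟫

  ≋0⇒deg⁺≡0 : ∀ {p} → p ≋ [] → deg⁺ p ≡ 0
  ≋0⇒deg⁺≡0 {p} e = ≡.cong length (strip-cong e)

  DegBelow0⇒≋0 : ∀ {p} → DegBelow p 0 → p ≋ []
  DegBelow0⇒≋0 (degBelow b) = ⟪ (λ n → b n z≤n) ⟫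

  DegBelow-mono : ∀ {p m n} → DegBelow p m → m ≤ n → DegBelow p n
  DegBelow-mono (degBelow b) le = degBelow λ k le′ → b k (ℕ.≤-trans le le′)

  DegBelow-⊕ : ∀ {p q n} → DegBelow p n → DegBelow q n → DegBelow (p ⊕ q) n
  DegBelow-⊕ {p} {q} (degBelow bp) (degBelow bq) = degBelow λ m le →
    ≡.trans (coeff-⊕ p q m) (≡.trans (≡.cong₂ _+_ (bp m le) (bq m le)) (+-identityʳ 0#))

  DegBelow-negP : ∀ {p n} → DegBelow p n → DegBelow (negP p) n
  DegBelow-negP {p} (degBelow bp) = degBelow λ m le →
    ≡.trans (coeff-negP p m) (≡.trans (≡.cong -_ (bp m le)) -0#≈0#)

  DegBelow-lower : ∀ {p m} → DegBelow p (suc m) → coeff p m ≡ 0# → DegBelow p m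
  DegBelow-lower {p} {m} (degBelow b) c = degBelow go
    where
    go : ∀ k → m ≤ k → coeff p k ≡ 0#
    go k le with ℕ.m≤n⇒m<n∨m≡n le
    ... | inj₁ lt = b k lt
    ... | inj₂ ≡.refl = c

  coeff-∷⊗ : ∀ a p q m → coeff ((a ∷ p) ⊗ q) m ≡ (a * coeff q m) + coeff (shift (p ⊗ q)) m
  coeff-∷⊗ a p q m = ≡.trans (coeff-⊕ (a · q) (shift (p ⊗ q)) m) (≡.cong (_+ coeff (shift (p ⊗ q)) m) (coeff-· a q m))

  DegBelow-⊗ : ∀ p q i j → DegBelow p (suc i) → DegBelow q (suc j)
          → DegBelow (p ⊗ q) (suc (i ℕ.+ j)) × (coeff (p ⊗ q) (i ℕ.+ j) ≡ coeff p i * coeff q j)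
  DegBelow-⊗ [] q i j bp bq = degBelow (λ m _ → ≡.refl) , ≡.sym (zeroˡ _)
  DegBelow-⊗ (a ∷ p) q zero j (degBelow bp) (degBelow bq) = degBelow bnd , top
    where
    p0 : (p ⊗ q) ≋ []
    p0 = ⊗-zeroˡ q (DegBelow0⇒≋0 {p} (degBelow λ m le → bp (suc m) (s≤s le)))
    xz : ∀ m → coeff (shift (p ⊗ q)) m ≡ 0#
    xz m = coeff≡ (shift-zero p0) m
    bnd : ∀ m → suc j ≤ m → coeff ((a ∷ p) ⊗ q) m ≡ 0#
    bnd m le = ≡.trans (coeff-∷⊗ a p q m) (≡.trans (≡.cong₂ _+_ (≡.trans (≡.cong (a *_) (bq m le)) (zeroʳ a)) (xz m)) (+-identityʳ 0#))
    top : coeff ((a ∷ p) ⊗ q) j ≡ a * coeff q j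
    top = ≡.trans (coeff-∷⊗ a p q j) (≡.trans (≡.cong ((a * coeff q j) +_) (xz j)) (+-identityʳ _))
  DegBelow-⊗ (a ∷ p) q (suc i) j (degBelow bp) (degBelow bq) = degBelow bnd , top
    where
    ih = DegBelow-⊗ p q i j (degBelow λ m le → bp (suc m) (s≤s le)) (degBelow bq)
    bnd : ∀ m → suc (suc (i ℕ.+ j)) ≤ m → coeff ((a ∷ p) ⊗ q) m ≡ 0#
    bnd (suc m) (s≤s le) = ≡.trans (coeff-∷⊗ a p q (suc m))
      (≡.trans (≡.cong₂ _+_ (≡.trans (≡.cong (a *_) (bq (suc m) (s≤s j≤m))) (zeroʳ a)) (vanishes (proj₁ ih) m le))
               (+-identityʳ 0#))
      where
      j≤m : j ℕ.≤ m
      j≤m = ℕ.≤-trans (ℕ.m≤n+m j i) (ℕ.≤-trans (ℕ.n≤1+n _) le)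
    top : coeff ((a ∷ p) ⊗ q) (suc (i ℕ.+ j)) ≡ coeff p i * coeff q j
    top = ≡.trans (coeff-∷⊗ a p q (suc (i ℕ.+ j)))
      (≡.trans (≡.cong₂ _+_ (≡.trans (≡.cong (a *_) (bq (suc (i ℕ.+ j)) (s≤s (ℕ.m≤n+m j i)))) (zeroʳ a)) (proj₂ ih))
               (+-identityˡ _))

  deg⁺-⊗ : ∀ {p q i j} → deg⁺ p ≡ suc i → deg⁺ q ≡ suc j → deg⁺ (p ⊗ q) ≡ suc (i ℕ.+ j)
  deg⁺-⊗ {p} {q} {i} {j} ep eq =
    deg⁺-exact (proj₁ mb) (λ c → *-nonzero (leading≢0 p i ep) (leading≢0 q j eq) (≡.trans (≡.sym (proj₂ mb)) c))
    where
    mb = DegBelow-⊗ p q i j (≡.subst (DegBelow p) ep (DegBelow-deg⁺ p)) (≡.subst (DegBelow q) eq (DegBelow-deg⁺ q))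

  deg⁺-⊗-zeroˡ : ∀ {p} q → deg⁺ p ≡ 0 → deg⁺ (p ⊗ q) ≡ 0
  deg⁺-⊗-zeroˡ {p} q e = ≋0⇒deg⁺≡0 {p ⊗ q} (⊗-zeroˡ q (deg⁺≡0⇒≋0 {p} e))

  deg⁺-⊗-zeroʳ : ∀ p {q} → deg⁺ q ≡ 0 → deg⁺ (p ⊗ q) ≡ 0
  deg⁺-⊗-zeroʳ p {q} e = ≋0⇒deg⁺≡0 {p ⊗ q} (≋-trans (⊗-congʳ p (deg⁺≡0⇒≋0 {q} e)) (⊗-zeroʳ p))

  deg⁺-oneP : deg⁺ oneP ≡ 1
  deg⁺-oneP = deg⁺-exact {oneP} {0} (degBelow λ { (suc m) _ → ≡.refl }) 1≢0
  open IntegerCoefficientSolver polyRing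

  infix 4 _∣′_

  record _∣′_ (d p : Pol) : Set where
    constructor divides
    field
      quotient : Pol
      equation : p ≋ (d ⊗ quotient)
  open _∣′_ public

  Unit : Pol → Set
  Unit u = u ∣′ oneP

  ∣′-refl : ∀ a → a ∣′ a
  ∣′-refl a = divides oneP (≋-sym (⊗-identityʳ a))

  ∣′-zero : ∀ a {b} → b ≋ [] → a ∣′ b
  ∣′-zero a b≋0 = divides [] (≋-trans b≋0 (≋-sym (⊗-zeroʳ a)))

  ∣′-respʳ : ∀ {a b b′} → b ≋ b′ → a ∣′ b → a ∣′ b′
  ∣′-respʳ b≋b′ (divides h e) = divides h (≋-trans (≋-sym b≋b′) e)

  ∣′-respˡ : ∀ {a a′ b} → a ≋ a′ → a ∣′ b → a′ ∣′ b
  ∣′-respˡ a≋a′ (divides h e) = divides h (≋-trans e (⊗-congˡ h a≋a′))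

  ∣′-trans : ∀ {a b c} → a ∣′ b → b ∣′ c → a ∣′ c
  ∣′-trans {a} (divides h₁ e₁) (divides h₂ e₂) =
    divides (h₁ ⊗ h₂) (≋-trans e₂ (≋-trans (⊗-congˡ h₂ e₁) (⊗-assoc a h₁ h₂)))

  p∣′p⊗q : ∀ p q → p ∣′ (p ⊗ q)
  p∣′p⊗q p q = divides q ≋-refl

  ∣′-⊗ʳ : ∀ {a b} → a ∣′ b → ∀ c → a ∣′ (b ⊗ c)
  ∣′-⊗ʳ a∣b c = ∣′-trans a∣b (p∣′p⊗q _ c)

  ∣′-⊗ˡ : ∀ {a b} → a ∣′ b → ∀ c → a ∣′ (c ⊗ b)
  ∣′-⊗ˡ {b = b} a∣b c = ∣′-respʳ (⊗-comm b c) (∣′-⊗ʳ a∣b c)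

  ∣′-⊕ : ∀ {a b c} → a ∣′ b → a ∣′ c → a ∣′ (b ⊕ c)
  ∣′-⊕ {a} (divides h₁ e₁) (divides h₂ e₂) = divides (h₁ ⊕ h₂) (≋-trans (⊕-cong e₁ e₂) (≋-sym (⊗-distribˡ a h₁ h₂)))

  ∣′-negP : ∀ {a b} → a ∣′ b → a ∣′ negP b
  ∣′-negP {a} (divides h e) = divides (negP h) (≋-trans (negP-cong e) (solve 2 (λ a h → :- (a :* h) := a :* (:- h)) ≋-refl a h))

  ∣′-⊖ : ∀ {a b c} → a ∣′ b → a ∣′ c → a ∣′ (b ⊖ c)
  ∣′-⊖ a∣b a∣c = ∣′-⊕ a∣b (∣′-negP a∣c)

  unit⇒deg⁺≡1 : ∀ {u} → Unit u → deg⁺ u ≡ 1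
  unit⇒deg⁺≡1 {u} (divides h e) with deg⁺ u in eu | deg⁺ h in eh
  ... | zero  | _     = contradiction (≡.trans (≡.sym (deg⁺-⊗-zeroˡ {u} h eu)) (≡.trans (≡.sym (deg⁺-cong e)) deg⁺-oneP)) ℕ.0≢1+n
  ... | suc i | zero  = contradiction (≡.trans (≡.sym (deg⁺-⊗-zeroʳ u {h} eh)) (≡.trans (≡.sym (deg⁺-cong e)) deg⁺-oneP)) ℕ.0≢1+n
  ... | suc i | suc j = ≡.cong suc (ℕ.m+n≡0⇒m≡0 i (ℕ.suc-injective
    (≡.trans (≡.sym (deg⁺-⊗ {u} {h} eu eh)) (≡.trans (≡.sym (deg⁺-cong e)) deg⁺-oneP))))

  deg⁺≡1⇒unit : ∀ {u} → deg⁺ u ≡ 1 → Unit u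
  deg⁺≡1⇒unit {u} deg⁺u≡1 with inverse (coeff u 0) (leading≢0 u 0 deg⁺u≡1)
  ... | c⁻¹ , cc⁻¹≡1 = divides (c⁻¹ ∷ []) ⟪ (λ n → ≡.sym (coeff-u⊗c⁻¹ n)) ⟫
    where
    product = DegBelow-⊗ u (c⁻¹ ∷ []) 0 0 (≡.subst (DegBelow u) deg⁺u≡1 (DegBelow-deg⁺ u)) (degBelow λ { (suc m) _ → ≡.refl })
    coeff-u⊗c⁻¹ : ∀ n → coeff (u ⊗ (c⁻¹ ∷ [])) n ≡ coeff oneP n
    coeff-u⊗c⁻¹ zero    = ≡.trans (proj₂ product) cc⁻¹≡1
    coeff-u⊗c⁻¹ (suc n) = vanishes (proj₁ product) (suc n) (s≤s z≤n)

  ∣′⇒deg⁺≤ : ∀ {a b} → a ∣′ b → ¬ b ≋ [] → deg⁺ a ≤ deg⁺ b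
  ∣′⇒deg⁺≤ {a} {b} (divides h e) b≉0 with deg⁺ a in ea | deg⁺ h in eh
  ... | zero  | _     = z≤n
  ... | suc i | zero  = contradiction (deg⁺≡0⇒≋0 (≡.trans (deg⁺-cong e) (deg⁺-⊗-zeroʳ a {h} eh))) b≉0
  ... | suc i | suc j = ≡.subst (suc i ≤_) (≡.sym (≡.trans (deg⁺-cong e) (deg⁺-⊗ {a} {h} ea eh))) (s≤s (ℕ.m≤m+n i j))

  monomial : ℕ → Carrier → Pol
  monomial zero    b = b ∷ []
  monomial (suc e) b = 0# ∷ monomial e b

  DegBelow-monomial : ∀ e b → DegBelow (monomial e b) (suc e)
  DegBelow-monomial zero    b = degBelow λ { (suc m) _ → ≡.refl }
  DegBelow-monomial (suc e) b = degBelow λ { (suc m) (s≤s le) → vanishes (DegBelow-monomial e b) m le }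

  coeff-monomial : ∀ e b → coeff (monomial e b) e ≡ b
  coeff-monomial zero    b = ≡.refl
  coeff-monomial (suc e) b = coeff-monomial e b

  module DivisionBy (f : Pol) (k : ℕ) (deg⁺f≡ : deg⁺ f ≡ suc k) where

    record DivMod (a : Pol) : Set where
      constructor divMod
      field
        quot rem  : Pol
        split     : a ≋ ((quot ⊗ f) ⊕ rem)
        rem-small : DegBelow rem k

    -- Each step removes the coefficient of a at X^m by subtracting (a_m / lc f) X^(m-k) f.
    divMod′ : ∀ n a → DegBelow a n → DivMod a
    divMod′ zero    a a<n = divMod [] a ≋-refl (DegBelow-mono a<n z≤n)
    divMod′ (suc m) a a<n with suc m ≤? k
    ... | yes m<k = divMod [] a ≋-refl (DegBelow-mono a<n m<k)
    ... | no  m≮k = divMod (quot ⊕ M) rem split′ rem-small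
      where
      k≤m : k ≤ m
      k≤m = ℕ.≤-pred (ℕ.≰⇒> m≮k)
      lc⁻¹ : Carrier
      lc⁻¹ = proj₁ (inverse (coeff f k) (leading≢0 f k deg⁺f≡))
      M : Pol
      M = monomial (m ∸ k) (coeff a m * lc⁻¹)
      Mf = DegBelow-⊗ M f (m ∸ k) k (DegBelow-monomial (m ∸ k) _) (≡.subst (DegBelow f) deg⁺f≡ (DegBelow-deg⁺ f))
      [m∸k]+k≡m : (m ∸ k) ℕ.+ k ≡ m
      [m∸k]+k≡m = ℕ.m∸n+n≡m k≤m
      coeff-Mf : coeff (M ⊗ f) m ≡ coeff a m
      coeff-Mf = begin
        coeff (M ⊗ f) m                 ≡⟨ ≡.cong (coeff (M ⊗ f)) [m∸k]+k≡m ⟨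
        coeff (M ⊗ f) ((m ∸ k) ℕ.+ k)   ≡⟨ proj₂ Mf ⟩
        coeff M (m ∸ k) * coeff f k     ≡⟨ ≡.cong (_* coeff f k) (coeff-monomial (m ∸ k) _) ⟩
        (coeff a m * lc⁻¹) * coeff f k  ≡⟨ *-assoc _ _ _ ⟩
        coeff a m * (lc⁻¹ * coeff f k)  ≡⟨ ≡.cong (coeff a m *_) (≡.trans (*-comm _ _) (proj₂ (inverse (coeff f k) _))) ⟩
        coeff a m * 1#                  ≡⟨ *-identityʳ _ ⟩
        coeff a m                       ∎
        where open ≡.≡-Reasoning
      a′<m : DegBelow (a ⊖ (M ⊗ f)) m
      a′<m = DegBelow-lower
        (DegBelow-⊕ a<n (DegBelow-negP (≡.subst (λ z → DegBelow (M ⊗ f) (suc z)) [m∸k]+k≡m (proj₁ Mf))))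
        (≡.trans (coeff-⊕ a _ m) (≡.trans (≡.cong (coeff a m +_) (≡.trans (coeff-negP (M ⊗ f) m) (≡.cong -_ coeff-Mf))) (-‿inverseʳ _)))
      open DivMod (divMod′ m (a ⊖ (M ⊗ f)) a′<m)
      split′ : a ≋ (((quot ⊕ M) ⊗ f) ⊕ rem)
      split′ = begin
        a                                  ≈⟨ solve 2 (λ a P → a := (a :- P) :+ P) ≋-refl a (M ⊗ f) ⟩
        ((a ⊖ (M ⊗ f)) ⊕ (M ⊗ f))       ≈⟨ ⊕-cong split (≋-refl {M ⊗ f}) ⟩
        (((quot ⊗ f) ⊕ rem) ⊕ (M ⊗ f))  ≈⟨ solve 4 (λ q f r M → (q :* f :+ r) :+ M :* f := (q :+ M) :* f :+ r) ≋-refl quot f rem M ⟩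
        (((quot ⊕ M) ⊗ f) ⊕ rem)        ∎
        where open SetoidReasoning ≋-setoid

    divMod-of : ∀ a → DivMod a
    divMod-of a = divMod′ (deg⁺ a) a (DegBelow-deg⁺ a)

    ∣′-small⇒≋0 : ∀ {r} → f ∣′ r → DegBelow r k → r ≋ []
    ∣′-small⇒≋0 {r} f∣r r<k with deg⁺ r in deg⁺r≡
    ... | zero  = deg⁺≡0⇒≋0 deg⁺r≡
    ... | suc j = contradiction (ℕ.≤-trans f≤r (DegBelow⇒deg⁺≤ r<k)) (ℕ.<-irrefl ≡.refl)
      where
      f≤r : suc k ≤ deg⁺ r
      f≤r = ≡.subst (_≤ deg⁺ r) deg⁺f≡ (∣′⇒deg⁺≤ f∣r (λ r≋0 → ℕ.0≢1+n (≡.trans (≡.sym (≋0⇒deg⁺≡0 r≋0)) deg⁺r≡)))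

    f∣′? : ∀ a → Dec (f ∣′ a)
    f∣′? a with divMod-of a
    ... | divMod q r a≋qf+r r<k with deg⁺ r in deg⁺r≡
    ...   | zero  = yes (divides q (≋-trans a≋qf+r (≋-trans (⊕-cong (⊗-comm q f) (deg⁺≡0⇒≋0 deg⁺r≡)) (⊕-identityʳ (f ⊗ q)))))
    ...   | suc j = no λ f∣a → ℕ.0≢1+n (≡.trans (≡.sym (≋0⇒deg⁺≡0 (∣′-small⇒≋0 (f∣r f∣a) r<k))) deg⁺r≡)
      where
      f∣r : f ∣′ a → f ∣′ r
      f∣r f∣a = ∣′-respʳ (≋-trans (⊕-cong a≋qf+r ≋-refl) (solve 2 (λ x r → (x :+ r) :- x := r) ≋-refl (q ⊗ f) r))
                         (∣′-⊖ f∣a (∣′-⊗ˡ (∣′-refl f) q))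

  _∣′?_ : ∀ d a → Dec (d ∣′ a)
  d ∣′? a with deg⁺ d in deg⁺d≡
  ... | suc k = DivisionBy.f∣′? d k deg⁺d≡ a
  ... | zero with deg⁺ a in deg⁺a≡
  ...   | zero  = yes (∣′-zero d (deg⁺≡0⇒≋0 deg⁺a≡))
  ...   | suc j = no λ d∣a → ℕ.0≢1+n
    (≡.trans (≡.sym (≡.trans (deg⁺-cong (equation d∣a)) (deg⁺-⊗-zeroˡ {d} (quotient d∣a) deg⁺d≡))) deg⁺a≡)

  record GcdBezout (a b : Pol) : Set where
    field
      gcd      : Pol
      u v      : Pol
      gcd∣a    : gcd ∣′ a
      gcd∣b    : gcd ∣′ b
      bezout   : gcd ≋ ((u ⊗ a) ⊕ (v ⊗ b))

  extendedEuclid′ : ∀ n a b → deg⁺ b ≤ n → GcdBezout a b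
  extendedEuclid′ n a b deg⁺b≤n with deg⁺ b in deg⁺b≡
  ... | zero = record
    { gcd = a ; u = oneP ; v = [] ; gcd∣a = ∣′-refl a ; gcd∣b = ∣′-zero a (deg⁺≡0⇒≋0 deg⁺b≡)
    ; bezout = ≋-sym (≋-trans (⊕-identityʳ (oneP ⊗ a)) (⊗-identityˡ a)) }
  extendedEuclid′ (suc n) a b (s≤s deg⁺b≤n) | suc k = record
    { gcd = gcd ; u = v ; v = u ⊖ (v ⊗ q) ; gcd∣a = gcd∣a′ ; gcd∣b = gcd∣a ; bezout = bezout′ }
    where
    open DivisionBy b k deg⁺b≡ using (module DivMod; divMod-of)
    open DivMod (divMod-of a) renaming (quot to q; rem to r; split to a≋qb+r; rem-small to r<k)
    open GcdBezout (extendedEuclid′ n b r (ℕ.≤-trans (DegBelow⇒deg⁺≤ r<k) deg⁺b≤n))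
    gcd∣a′ : gcd ∣′ a
    gcd∣a′ = ∣′-respʳ (≋-sym a≋qb+r) (∣′-⊕ (∣′-⊗ˡ gcd∣a q) gcd∣b)
    bezout′ : gcd ≋ ((v ⊗ a) ⊕ ((u ⊖ (v ⊗ q)) ⊗ b))
    bezout′ = begin
      gcd                              ≈⟨ bezout ⟩
      ((u ⊗ b) ⊕ (v ⊗ r))              ≈⟨ ⊕-cong (≋-refl {u ⊗ b}) (⊗-congʳ v r≋a-qb) ⟩
      ((u ⊗ b) ⊕ (v ⊗ (a ⊖ (q ⊗ b))))  ≈⟨ solve 5 (λ u b v a q → u :* b :+ v :* (a :- q :* b) := v :* a :+ (u :- v :* q) :* b) ≋-refl u b v a q ⟩
      ((v ⊗ a) ⊕ ((u ⊖ (v ⊗ q)) ⊗ b))  ∎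
      where
      open SetoidReasoning ≋-setoid
      r≋a-qb : r ≋ (a ⊖ (q ⊗ b))
      r≋a-qb = ≋-trans (solve 2 (λ x r → r := (x :+ r) :- x) ≋-refl (q ⊗ b) r) (⊕-cong (≋-sym a≋qb+r) ≋-refl)

  extendedEuclid : ∀ a b → GcdBezout a b
  extendedEuclid a b = extendedEuclid′ (deg⁺ b) a b ℕ.≤-refl

  Irreducible′ : Pol → Set
  Irreducible′ P = ¬ (P ≋ []) × ¬ Unit P × (∀ a b → P ≋ (a ⊗ b) → Unit a ⊎ Unit b)

  Coprime′ : Pol → Pol → Set
  Coprime′ a b = ∀ d → d ∣′ a → d ∣′ b → Unit d

  coprime⇒bezout : ∀ a b → Coprime′ a b → ∃ λ u → ∃ λ v → oneP ≋ ((u ⊗ a) ⊕ (v ⊗ b))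
  coprime⇒bezout a b coprime = (h ⊗ u) , (h ⊗ v) , (begin
    oneP                       ≈⟨ equation gcd-unit ⟩
    (gcd ⊗ h)                  ≈⟨ ⊗-congˡ h bezout ⟩
    (((u ⊗ a) ⊕ (v ⊗ b)) ⊗ h)  ≈⟨ solve 5 (λ u a v b h → (u :* a :+ v :* b) :* h := (h :* u) :* a :+ (h :* v) :* b) ≋-refl u a v b h ⟩
    (((h ⊗ u) ⊗ a) ⊕ ((h ⊗ v) ⊗ b))     ∎)
    where
    open SetoidReasoning ≋-setoid
    open GcdBezout (extendedEuclid a b)
    gcd-unit : Unit gcd
    gcd-unit = coprime gcd gcd∣a gcd∣b
    h = quotient gcd-unit

  euclid : ∀ {a b c} → Coprime′ a c → a ∣′ (b ⊗ c) → a ∣′ b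
  euclid {a} {b} {c} coprime a∣bc = ∣′-respʳ (≋-sym b≋) (∣′-⊕ (p∣′p⊗q a (u ⊗ b)) (∣′-⊗ʳ a∣bc v))
    where
    u = proj₁ (coprime⇒bezout a c coprime)
    v = proj₁ (proj₂ (coprime⇒bezout a c coprime))
    b≋ : b ≋ ((a ⊗ (u ⊗ b)) ⊕ ((b ⊗ c) ⊗ v))
    b≋ = begin
      b                                   ≈⟨ ⊗-identityˡ b ⟨
      (oneP ⊗ b)                 ≈⟨ ⊗-congˡ b (proj₂ (proj₂ (coprime⇒bezout a c coprime))) ⟩
      (((u ⊗ a) ⊕ (v ⊗ c)) ⊗ b)  ≈⟨ solve 5 (λ u a v c b → (u :* a :+ v :* c) :* b := a :* (u :* b) :+ (b :* c) :* v) ≋-refl u a v c b ⟩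
      ((a ⊗ (u ⊗ b)) ⊕ ((b ⊗ c) ⊗ v))  ∎
      where open SetoidReasoning ≋-setoid

  -- The gcd g of P and a satisfies P ≋ g h, so either g is a unit (P, a coprime) or h is (P ∣ g ∣ a).
  irreducible⇒prime : ∀ {P} → Irreducible′ P → ∀ a b → P ∣′ (a ⊗ b) → P ∣′ a ⊎ P ∣′ b
  irreducible⇒prime {P} (_ , _ , irreducible) a b P∣ab = cases (irreducible gcd h (equation gcd∣a))
    where
    open GcdBezout (extendedEuclid P a)
    h = quotient gcd∣a
    cases : Unit gcd ⊎ Unit h → P ∣′ a ⊎ P ∣′ b
    cases (inj₁ gcd-unit) = inj₂ (euclid coprime (∣′-respʳ (⊗-comm a b) P∣ab))
      where
      coprime : Coprime′ P a
      coprime d d∣P d∣a = ∣′-trans (∣′-respʳ (≋-sym bezout) (∣′-⊕ (∣′-⊗ˡ d∣P u) (∣′-⊗ˡ d∣a v))) gcd-unit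
    cases (inj₂ (divides h′ 1≋hh′)) = inj₁ (∣′-trans (∣′-respʳ P⊗h′≋gcd (p∣′p⊗q P h′)) gcd∣b)
      where
      P⊗h′≋gcd : (P ⊗ h′) ≋ gcd
      P⊗h′≋gcd = ≋-trans (⊗-congˡ h′ (equation gcd∣a))
                 (≋-trans (⊗-assoc gcd h h′) (≋-trans (⊗-congʳ gcd (≋-sym 1≋hh′)) (⊗-identityʳ gcd)))

  polysOfLength : ℕ → List Pol
  polysOfLength zero    = [] ∷ []
  polysOfLength (suc n) = cartesianProductWith _∷_ elements (polysOfLength n)

  padTo : ℕ → Pol → Pol
  padTo zero    p       = []
  padTo (suc n) []      = 0# ∷ padTo n []
  padTo (suc n) (a ∷ p) = a ∷ padTo n p

  padTo-∈ : ∀ n p → padTo n p ∈ polysOfLength n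
  padTo-∈ zero    p       = here ≡.refl
  padTo-∈ (suc n) []      = ∈-cartesianProductWith⁺ _∷_ (elements-complete 0#) (padTo-∈ n [])
  padTo-∈ (suc n) (a ∷ p) = ∈-cartesianProductWith⁺ _∷_ (elements-complete a) (padTo-∈ n p)

  padTo-≋ : ∀ n p → DegBelow p n → padTo n p ≋ p
  padTo-≋ zero    p       p<0 = ≋-sym (DegBelow0⇒≋0 p<0)
  padTo-≋ (suc n) []      _   =
    ≋-trans (∷-cong ≡.refl (padTo-≋ n [] (degBelow λ _ _ → ≡.refl))) ⟪ (λ { zero → ≡.refl ; (suc _) → ≡.refl }) ⟫
  padTo-≋ (suc n) (a ∷ p) (degBelow p<n) = ∷-cong ≡.refl (padTo-≋ n p (degBelow λ m le → p<n (suc m) (s≤s le)))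

  polysOfLength-complete : ∀ {n p} → deg⁺ p ≤ n → Any (_≋ p) (polysOfLength n)
  polysOfLength-complete {n} {p} deg⁺p≤n =
    Any.map (λ { ≡.refl → padTo-≋ n p (DegBelow-mono (DegBelow-deg⁺ p) deg⁺p≤n) }) (padTo-∈ n p)

  factor-cases : ∀ {d a b} → ¬ d ≋ [] → d ≋ (a ⊗ b) → Unit a ⊎ Unit b ⊎ (2 ≤ deg⁺ a × deg⁺ a < deg⁺ d)
  factor-cases {d} {a} {b} d≉0 d≋ab with deg⁺ a in deg⁺a≡ | deg⁺ b in deg⁺b≡
  ... | zero          | _             = contradiction (≋-trans d≋ab (⊗-zeroˡ b (deg⁺≡0⇒≋0 {a} deg⁺a≡))) d≉0
  ... | suc _         | zero          = contradiction (≋-trans d≋ab (≋-trans (⊗-congʳ a (deg⁺≡0⇒≋0 {b} deg⁺b≡)) (⊗-zeroʳ a))) d≉0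
  ... | suc zero      | suc _         = inj₁ (deg⁺≡1⇒unit {a} deg⁺a≡)
  ... | suc (suc i)   | suc zero      = inj₂ (inj₁ (deg⁺≡1⇒unit {b} deg⁺b≡))
  ... | suc (suc i)   | suc (suc j)   = inj₂ (inj₂ (s≤s (s≤s z≤n) , ≡.subst (suc (suc i) <_) (≡.sym deg⁺d≡) a<ab))
    where
    deg⁺d≡ : deg⁺ d ≡ suc (suc i ℕ.+ suc j)
    deg⁺d≡ = ≡.trans (deg⁺-cong d≋ab) (deg⁺-⊗ {a} {b} deg⁺a≡ deg⁺b≡)
    a<ab : suc (suc i) < suc (suc i ℕ.+ suc j)
    a<ab = s≤s (s≤s (≡.subst (suc i ≤_) (≡.sym (ℕ.+-suc i j)) (s≤s (ℕ.m≤m+n i j))))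

  ProperFactor : Pol → Pol → Set
  ProperFactor d a = 2 ≤ deg⁺ a × deg⁺ a < deg⁺ d × a ∣′ d

  properFactor? : ∀ d a → Dec (ProperFactor d a)
  properFactor? d a = (2 ≤? deg⁺ a) ×-dec (suc (deg⁺ a) ≤? deg⁺ d) ×-dec (a ∣′? d)

  nonzero-nonunit : ∀ {a} → 2 ≤ deg⁺ a → ¬ a ≋ [] × ¬ Unit a
  nonzero-nonunit {a} 2≤a = (λ a≋0 → contradiction (≡.subst (2 ≤_) (≋0⇒deg⁺≡0 a≋0) 2≤a) λ ())
                          , (λ a-unit → contradiction (≡.subst (2 ≤_) (unit⇒deg⁺≡1 a-unit) 2≤a) λ { (s≤s ()) })

  -- If no factor of smaller degree exists (a finite search), d itself is irreducible.
  irreducibleFactor : ∀ d → ¬ d ≋ [] → ¬ Unit d → ∃ λ P → Irreducible′ P × P ∣′ d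
  irreducibleFactor d = <-rec Goal step (deg⁺ d) d ≡.refl
    where
    Goal : ℕ → Set
    Goal n = ∀ d → deg⁺ d ≡ n → ¬ d ≋ [] → ¬ Unit d → ∃ λ P → Irreducible′ P × P ∣′ d
    step : ∀ n → (∀ {m} → m < n → Goal m) → Goal n
    step n rec d ≡.refl d≉0 d-nonunit = cases (any? (properFactor? d) (polysOfLength (deg⁺ d)))
      where
      cases : Dec (Any (ProperFactor d) (polysOfLength (deg⁺ d))) → ∃ λ P → Irreducible′ P × P ∣′ d
      cases (yes factor) =
        let a , _ , (2≤a , a<d , a∣d) = find factor
            P , P-irreducible , P∣a = rec a<d a ≡.refl (proj₁ (nonzero-nonunit 2≤a)) (proj₂ (nonzero-nonunit 2≤a))
        in P , P-irreducible , ∣′-trans P∣a a∣d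
      cases (no no-factor) = d , (d≉0 , d-nonunit , irreducible) , ∣′-refl d
        where
        irreducible : ∀ a b → d ≋ (a ⊗ b) → Unit a ⊎ Unit b
        irreducible a b d≋ab with factor-cases d≉0 d≋ab
        ... | inj₁ a-unit             = inj₁ a-unit
        ... | inj₂ (inj₁ b-unit)      = inj₂ b-unit
        ... | inj₂ (inj₂ (2≤a , a<d)) = contradiction (Any.map proper (polysOfLength-complete (ℕ.<⇒≤ a<d))) no-factor
          where
          proper : ∀ {a′} → a′ ≋ a → ProperFactor d a′
          proper a′≋a = ≡.subst (2 ≤_) (≡.sym (deg⁺-cong a′≋a)) 2≤a
                      , ≡.subst (_< deg⁺ d) (≡.sym (deg⁺-cong a′≋a)) a<d
                      , ∣′-respˡ (≋-sym a′≋a) (∣′-respʳ (≋-sym d≋ab) (p∣′p⊗q a b))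

  nonzero-nonunit⇒deg⁺≥2 : ∀ {d} → ¬ d ≋ [] → ¬ Unit d → ∃ λ i → deg⁺ d ≡ suc (suc i)
  nonzero-nonunit⇒deg⁺≥2 {d} d≉0 d-nonunit with deg⁺ d in deg⁺d≡
  ... | zero        = contradiction (deg⁺≡0⇒≋0 deg⁺d≡) d≉0
  ... | suc zero    = contradiction (deg⁺≡1⇒unit deg⁺d≡) d-nonunit
  ... | suc (suc i) = i , ≡.refl

  unit⊗-∣′ : ∀ {u} → Unit u → ∀ p → (u ⊗ p) ∣′ p
  unit⊗-∣′ {u} (divides w 1≋uw) p = divides w (begin
    p                  ≈⟨ ⊗-identityˡ p ⟨
    (oneP ⊗ p)     ≈⟨ ⊗-congˡ p 1≋uw ⟩
    ((u ⊗ w) ⊗ p)  ≈⟨ solve 3 (λ u w p → (u :* w) :* p := (u :* p) :* w) ≋-refl u w p ⟩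
    ((u ⊗ p) ⊗ w)      ∎)
    where open SetoidReasoning ≋-setoid

  Irreducible′-unit⊗ : ∀ {P u} → Unit u → Irreducible′ P → Irreducible′ (u ⊗ P)
  Irreducible′-unit⊗ {P} {u} u-unit (P≉0 , P-nonunit , irreducible) = uP≉0 , uP-nonunit , uP-irreducible
    where
    uP∣P = unit⊗-∣′ u-unit P
    w = quotient uP∣P
    uP≉0 : ¬ (u ⊗ P) ≋ []
    uP≉0 uP≋0 = P≉0 (≋-trans (equation uP∣P) (⊗-zeroˡ w uP≋0))
    uP-nonunit : ¬ Unit (u ⊗ P)
    uP-nonunit uP-unit = P-nonunit (∣′-trans (∣′-respʳ (⊗-comm P u) (p∣′p⊗q P u)) uP-unit)
    uP-irreducible : ∀ a b → (u ⊗ P) ≋ (a ⊗ b) → Unit a ⊎ Unit b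
    uP-irreducible a b uP≋ab = Sum.map₁ (λ aw-unit → ∣′-trans (p∣′p⊗q a w) aw-unit) (irreducible (a ⊗ w) b P≋awb)
      where
      P≋awb : P ≋ ((a ⊗ w) ⊗ b)
      P≋awb = ≋-trans (equation uP∣P) (≋-trans (⊗-congˡ w uP≋ab) (solve 3 (λ a b w → (a :* b) :* w := (a :* w) :* b) ≋-refl a b w))

  nonzero⇒deg⁺≡suc-deg : ∀ {P} → ¬ P ≋ [] → deg⁺ P ≡ suc (deg P)
  nonzero⇒deg⁺≡suc-deg {P} P≉0 with deg⁺ P in deg⁺P≡
  ... | zero  = contradiction (deg⁺≡0⇒≋0 deg⁺P≡) P≉0
  ... | suc _ = ≡.refl

  leading≡1⇒monic : ∀ {P i} → deg⁺ P ≡ suc i → coeff P i ≡ 1# → Monic P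
  leading≡1⇒monic {P} deg⁺P≡ leading≡1 = ≡.subst (λ n → coeff P (n ∸ 1) ≡ 1#) (≡.sym deg⁺P≡) leading≡1

  -- Scale an irreducible factor by the inverse of its leading coefficient.
  monicIrreducibleFactor : ∀ d → ¬ d ≋ [] → ¬ Unit d → ∃ λ P → Monic P × Irreducible′ P × P ∣′ d
  monicIrreducibleFactor d d≉0 d-nonunit =
    (u ⊗ P₀) , leading≡1⇒monic {u ⊗ P₀} deg⁺uP₀≡ leading≡1 , Irreducible′-unit⊗ u-unit P₀-irreducible
             , ∣′-trans (unit⊗-∣′ u-unit P₀) P₀∣d
    where
    P₀ = proj₁ (irreducibleFactor d d≉0 d-nonunit)
    P₀-irreducible = proj₁ (proj₂ (irreducibleFactor d d≉0 d-nonunit))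
    P₀∣d = proj₂ (proj₂ (irreducibleFactor d d≉0 d-nonunit))
    i = deg P₀
    deg⁺P₀≡ : deg⁺ P₀ ≡ suc i
    deg⁺P₀≡ = nonzero⇒deg⁺≡suc-deg (proj₁ P₀-irreducible)
    lc≢0 : ¬ coeff P₀ i ≡ 0#
    lc≢0 = leading≢0 P₀ i deg⁺P₀≡
    lc⁻¹ = proj₁ (inverse (coeff P₀ i) lc≢0)
    lc*lc⁻¹≡1 = proj₂ (inverse (coeff P₀ i) lc≢0)
    u : Pol
    u = lc⁻¹ ∷ []
    u<1 : DegBelow u 1
    u<1 = degBelow λ { (suc m) _ → ≡.refl }
    u-unit : Unit u
    u-unit = deg⁺≡1⇒unit (deg⁺-exact u<1 λ lc⁻¹≡0 →
      1≢0 (≡.trans (≡.sym lc*lc⁻¹≡1) (≡.trans (≡.cong (coeff P₀ i *_) lc⁻¹≡0) (zeroʳ _))))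
    deg⁺uP₀≡ : deg⁺ (u ⊗ P₀) ≡ suc (0 ℕ.+ i)
    deg⁺uP₀≡ = deg⁺-⊗ {u} {P₀} (unit⇒deg⁺≡1 u-unit) deg⁺P₀≡
    leading≡1 : coeff (u ⊗ P₀) (0 ℕ.+ i) ≡ 1#
    leading≡1 = ≡.trans (proj₂ (DegBelow-⊗ u P₀ 0 i u<1 (≡.subst (DegBelow P₀) deg⁺P₀≡ (DegBelow-deg⁺ P₀))))
                        (≡.trans (*-comm lc⁻¹ _) lc*lc⁻¹≡1)

  -- Q ∣ P forces P ≋ Q h with h a unit, i.e. a constant, which comparing leading coefficients shows is 1.
  monicIrreducible-∣′⇒≋ : ∀ {P Q} → Monic P → Monic Q → Irreducible′ P → Irreducible′ Q → Q ∣′ P → Q ≋ P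
  monicIrreducible-∣′⇒≋ {P} {Q} P-monic Q-monic (_ , _ , P-irreducible) (Q≉0 , Q-nonunit , _) (divides h P≋Qh)
    with P-irreducible Q h P≋Qh
  ... | inj₁ Q-unit = contradiction Q-unit Q-nonunit
  ... | inj₂ h-unit = ≋-sym (≋-trans P≋Qh (≋-trans (⊗-congʳ Q h≋1) (⊗-identityʳ Q)))
    where
    i = deg Q
    deg⁺Q≡ : deg⁺ Q ≡ suc i
    deg⁺Q≡ = nonzero⇒deg⁺≡suc-deg Q≉0
    h<1 : DegBelow h 1
    h<1 = ≡.subst (DegBelow h) (unit⇒deg⁺≡1 h-unit) (DegBelow-deg⁺ h)
    Qh = DegBelow-⊗ Q h i 0 (≡.subst (DegBelow Q) deg⁺Q≡ (DegBelow-deg⁺ Q)) h<1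
    degP≡i : deg P ≡ i ℕ.+ 0
    degP≡i = ≡.cong (_∸ 1) (≡.trans (deg⁺-cong P≋Qh) (deg⁺-⊗ {Q} {h} deg⁺Q≡ (unit⇒deg⁺≡1 h-unit)))
    h₀≡1 : coeff h 0 ≡ 1#
    h₀≡1 = begin
      coeff h 0                ≡⟨ *-identityˡ _ ⟨
      1# * coeff h 0           ≡⟨ ≡.cong (_* coeff h 0) Q-monic ⟨
      coeff Q i * coeff h 0    ≡⟨ proj₂ Qh ⟨
      coeff (Q ⊗ h) (i ℕ.+ 0)  ≡⟨ coeff≡ P≋Qh (i ℕ.+ 0) ⟨
      coeff P (i ℕ.+ 0)        ≡⟨ ≡.cong (coeff P) degP≡i ⟨
      coeff P (deg P)          ≡⟨ P-monic ⟩
      1#                       ∎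
      where open ≡.≡-Reasoning
    h≋1 : h ≋ oneP
    h≋1 = ⟪ (λ { zero → h₀≡1 ; (suc n) → vanishes h<1 (suc n) (s≤s z≤n) }) ⟫

  no-common-monicIrreducible⇒coprime : ∀ {a b} → ¬ a ≋ []
    → (∀ Q → Monic Q → Irreducible′ Q → Q ∣′ a → Q ∣′ b → ⊥) → Coprime′ a b
  no-common-monicIrreducible⇒coprime {a} {b} a≉0 no-common d d∣a d∣b with deg⁺ d ℕ.≟ 1
  ... | yes deg⁺d≡1 = deg⁺≡1⇒unit deg⁺d≡1
  ... | no  deg⁺d≢1 = ⊥-elim (no-common Q Q-monic Q-irreducible (∣′-trans Q∣d d∣a) (∣′-trans Q∣d d∣b))
    where
    d≉0 : ¬ d ≋ []
    d≉0 d≋0 = a≉0 (≋-trans (equation d∣a) (⊗-zeroˡ (quotient d∣a) d≋0))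
    factor = monicIrreducibleFactor d d≉0 (deg⁺d≢1 ∘ unit⇒deg⁺≡1)
    Q = proj₁ factor
    Q-monic = proj₁ (proj₂ factor)
    Q-irreducible = proj₁ (proj₂ (proj₂ factor))
    Q∣d = proj₂ (proj₂ (proj₂ factor))

  ∣⇒∣′ : ∀ {d p} → d ∣ p → d ∣′ p
  ∣⇒∣′ (h , e) = divides h ⟪ e ⟫

  ∣′⇒∣ : ∀ {d p} → d ∣′ p → d ∣ p
  ∣′⇒∣ (divides h ⟪ e ⟫) = h , e

  Irreducible⇒Irreducible′ : ∀ {P} → Irreducible P → Irreducible′ P
  Irreducible⇒Irreducible′ (P≉0 , P-nonunit , irreducible) =
    (P≉0 ∘ coeff≡) , (P-nonunit ∘ ∣′⇒∣) , λ a b e → Sum.map ∣⇒∣′ ∣⇒∣′ (irreducible a b (coeff≡ e))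

  Irreducible′⇒Irreducible : ∀ {P} → Irreducible′ P → Irreducible P
  Irreducible′⇒Irreducible (P≉0 , P-nonunit , irreducible) =
    (P≉0 ∘ ⟪_⟫) , (P-nonunit ∘ ∣⇒∣′) , λ a b e → Sum.map ∣′⇒∣ ∣′⇒∣ (irreducible a b ⟪ e ⟫)

  twoP : Pol
  twoP = oneP ⊕ oneP

  twoP-unit : ¬ (1# + 1#) ≡ 0# → Unit twoP
  twoP-unit 1+1≢0 = deg⁺≡1⇒unit (deg⁺-exact {twoP} {0} (degBelow λ { (suc m) _ → ≡.refl }) 1+1≢0)

  -1P : Pol
  -1P = negP oneP

  -- In odd characteristic, (x + 1) - (x - 1) = 2 is a unit.
  nonunit∤both-x±1 : ¬ (1# + 1#) ≡ 0# → ∀ {d} x → ¬ Unit d → d ∣′ (x ⊕ oneP) → d ∣′ (x ⊕ -1P) → ⊥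
  nonunit∤both-x±1 1+1≢0 {d} x d-nonunit d∣x+1 d∣x-1 =
    d-nonunit (∣′-trans (∣′-respʳ x+1-[x-1]≋2 (∣′-⊖ d∣x+1 d∣x-1)) (twoP-unit 1+1≢0))
    where
    x+1-[x-1]≋2 : ((x ⊕ oneP) ⊖ (x ⊕ -1P)) ≋ twoP
    x+1-[x-1]≋2 = solve 2 (λ x y → (x :+ y) :- (x :- y) := y :+ y) ≋-refl x oneP

  module Congruence (f : Pol) (k : ℕ) (deg⁺f≡ : deg⁺ f ≡ suc (suc k)) where

    infix 4 _≈ₘ_

    record _≈ₘ_ (a b : Pol) : Set where
      constructor mod
      field f∣′a⊖b : f ∣′ (a ⊖ b)
    open _≈ₘ_ public

    ≋⇒≈ₘ : ∀ {a b} → a ≋ b → a ≈ₘ b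
    ≋⇒≈ₘ {a} {b} a≋b = mod (∣′-zero f (≋-trans (⊕-cong a≋b (≋-refl {negP b})) (⊕-inverseʳ b)))

    ≈ₘ-refl : ∀ {a} → a ≈ₘ a
    ≈ₘ-refl = ≋⇒≈ₘ ≋-refl

    ≈ₘ-sym : ∀ {a b} → a ≈ₘ b → b ≈ₘ a
    ≈ₘ-sym {a} {b} (mod d) = mod (∣′-respʳ (solve 2 (λ a b → :- (a :- b) := b :- a) ≋-refl a b) (∣′-negP d))

    ≈ₘ-trans : ∀ {a b c} → a ≈ₘ b → b ≈ₘ c → a ≈ₘ c
    ≈ₘ-trans {a} {b} {c} (mod d) (mod e) = mod (∣′-respʳ (solve 3 (λ a b c → (a :- b) :+ (b :- c) := a :- c) ≋-refl a b c) (∣′-⊕ d e))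

    ≈ₘ-⊕ : ∀ {a b c d} → a ≈ₘ b → c ≈ₘ d → (a ⊕ c) ≈ₘ (b ⊕ d)
    ≈ₘ-⊕ {a} {b} {c} {d} (mod x) (mod y) =
      mod (∣′-respʳ (solve 4 (λ a b c d → (a :- b) :+ (c :- d) := (a :+ c) :- (b :+ d)) ≋-refl a b c d) (∣′-⊕ x y))

    ≈ₘ-negP : ∀ {a b} → a ≈ₘ b → negP a ≈ₘ negP b
    ≈ₘ-negP {a} {b} (mod x) = mod (∣′-respʳ (solve 2 (λ a b → :- (a :- b) := (:- a) :- (:- b)) ≋-refl a b) (∣′-negP x))

    ≈ₘ-⊗ : ∀ {a b c d} → a ≈ₘ b → c ≈ₘ d → (a ⊗ c) ≈ₘ (b ⊗ d)
    ≈ₘ-⊗ {a} {b} {c} {d} (mod x) (mod y) =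
      mod (∣′-respʳ (solve 4 (λ a b c d → (a :- b) :* c :+ b :* (c :- d) := (a :* c) :- (b :* d)) ≋-refl a b c d)
                    (∣′-⊕ (∣′-⊗ʳ x c) (∣′-⊗ˡ y b)))

    residueRing : CommutativeRing _ _
    residueRing = record
      { Carrier = Pol
      ; _≈_ = _≈ₘ_
      ; _+_ = _⊕_
      ; _*_ = _⊗_
      ; -_ = negP
      ; 0# = []
      ; 1# = oneP
      ; isCommutativeRing = record
        { isRing = record
          { +-isAbelianGroup = record
            { isGroup = record
              { isMonoid = record
                { isSemigroup = record
                  { isMagma = record
                    { isEquivalence = record { refl = ≈ₘ-refl ; sym = ≈ₘ-sym ; trans = ≈ₘ-trans } ; ∙-cong = ≈ₘ-⊕ }
                  ; assoc = λ x y z → ≋⇒≈ₘ (⊕-assoc x y z) }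
                ; identity = (λ x → ≋⇒≈ₘ (⊕-identityˡ x)) , (λ x → ≋⇒≈ₘ (⊕-identityʳ x)) }
              ; inverse = (λ x → ≋⇒≈ₘ (⊕-inverseˡ x)) , (λ x → ≋⇒≈ₘ (⊕-inverseʳ x))
              ; ⁻¹-cong = ≈ₘ-negP }
            ; comm = λ x y → ≋⇒≈ₘ (⊕-comm x y) }
          ; *-cong = ≈ₘ-⊗
          ; *-assoc = λ x y z → ≋⇒≈ₘ (⊗-assoc x y z)
          ; *-identity = (λ x → ≋⇒≈ₘ (⊗-identityˡ x)) , (λ x → ≋⇒≈ₘ (⊗-identityʳ x))
          ; distrib = (λ x y z → ≋⇒≈ₘ (⊗-distribˡ x y z)) , (λ x y z → ≋⇒≈ₘ (⊗-distribʳ y z x)) }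
        ; *-comm = λ x y → ≋⇒≈ₘ (⊗-comm x y) } }

    f≉0 : ¬ f ≋ []
    f≉0 f≋0 = ℕ.0≢1+n (≡.trans (≡.sym (≋0⇒deg⁺≡0 f≋0)) deg⁺f≡)

    f-nonunit : ¬ Unit f
    f-nonunit f-unit = ℕ.0≢1+n (ℕ.suc-injective (≡.trans (≡.sym (unit⇒deg⁺≡1 f-unit)) deg⁺f≡))

    f∤unit : ∀ {u} → Unit u → ¬ f ∣′ u
    f∤unit u-unit f∣u = f-nonunit (∣′-trans f∣u u-unit)

    1≉ₘ0 : ¬ oneP ≈ₘ []
    1≉ₘ0 (mod f∣1) = f∤unit (∣′-refl oneP) (∣′-respʳ (⊕-identityʳ oneP) f∣1)

    1≉ₘ-1 : ¬ (1# + 1#) ≡ 0# → ¬ oneP ≈ₘ -1P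
    1≉ₘ-1 1+1≢0 (mod f∣1+1) = f∤unit (twoP-unit 1+1≢0) (∣′-respʳ (solve 1 (λ y → y :- (:- y) := y :+ y) ≋-refl oneP) f∣1+1)

    open DivisionBy f (suc k) deg⁺f≡ using (module DivMod; divMod-of; ∣′-small⇒≋0; f∣′?)

    _≈ₘ?_ : ∀ a b → Dec (a ≈ₘ b)
    a ≈ₘ? b = Dec.map′ mod f∣′a⊖b (f∣′? (a ⊖ b))

    reduce : ∀ a → ∃ λ r → r ≈ₘ a × DegBelow r (suc k)
    reduce a = r , mod (divides (negP q) r-a≋f-q) , r<k
      where
      open DivMod (divMod-of a) renaming (quot to q; rem to r; split to a≋qf+r; rem-small to r<k)
      r-a≋f-q : (r ⊖ a) ≋ (f ⊗ negP q)
      r-a≋f-q = ≋-trans (⊕-cong (≋-refl {r}) (negP-cong a≋qf+r)) (solve 3 (λ r q f → r :- (q :* f :+ r) := f :* (:- q)) ≋-refl r q f)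

    ≈ₘ-small⇒≋ : ∀ {a b} → a ≈ₘ b → DegBelow a (suc k) → DegBelow b (suc k) → a ≋ b
    ≈ₘ-small⇒≋ {a} {b} (mod f∣a-b) a<k b<k = ≋-trans (solve 2 (λ a b → a := (a :- b) :+ b) ≋-refl a b)
      (≋-trans (⊕-cong (∣′-small⇒≋0 f∣a-b (DegBelow-⊕ a<k (DegBelow-negP b<k))) (≋-refl {b})) (⊕-identityˡ b))

    deg<⇒DegBelow : ∀ {g} → deg g < deg f → DegBelow g (suc k)
    deg<⇒DegBelow {g} deg-g<deg-f = DegBelow-mono (DegBelow-deg⁺ g) (pred< (deg⁺ g) (≡.subst (λ n → deg g < n ∸ 1) deg⁺f≡ deg-g<deg-f))
      where
      pred< : ∀ n → n ∸ 1 < suc k → n ≤ suc k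
      pred< zero    _ = z≤n
      pred< (suc n) n<k = n<k

    DegBelow⇒deg< : ∀ {g} → ¬ g ≋ [] → DegBelow g (suc k) → deg g < deg f
    DegBelow⇒deg< {g} g≉0 g<k = ≡.subst (λ n → deg g < n ∸ 1) (≡.sym deg⁺f≡)
      (≡.subst (λ n → n ∸ 1 < suc k) (≡.sym (nonzero⇒deg⁺≡suc-deg g≉0))
               (≡.subst (_≤ suc k) (nonzero⇒deg⁺≡suc-deg g≉0) (DegBelow⇒deg⁺≤ g<k)))

    invertible⇒coprime : ∀ {a b} → (a ⊗ b) ≈ₘ oneP → Coprime′ a f
    invertible⇒coprime {a} {b} (mod f∣ab-1) d d∣a d∣f = ∣′-respʳ (solve 2 (λ x y → x :- (x :- y) := y) ≋-refl (a ⊗ b) oneP)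
      (∣′-⊖ (∣′-⊗ʳ d∣a b) (∣′-trans d∣f f∣ab-1))

    coprime⇒invertible : ∀ {a} → Coprime′ a f → ∃ λ b → (a ⊗ b) ≈ₘ oneP
    coprime⇒invertible {a} coprime = u , mod (divides (negP v) (begin
      ((a ⊗ u) ⊖ oneP)                 ≈⟨ ⊕-cong (≋-refl {a ⊗ u}) (negP-cong 1≋ua+vf) ⟩
      ((a ⊗ u) ⊖ ((u ⊗ a) ⊕ (v ⊗ f)))  ≈⟨ solve 4 (λ a u v f → (a :* u) :- (u :* a :+ v :* f) := f :* (:- v)) ≋-refl a u v f ⟩
      (f ⊗ negP v)                        ∎))
      where
      open SetoidReasoning ≋-setoid
      u = proj₁ (coprime⇒bezout a f coprime)
      v = proj₁ (proj₂ (coprime⇒bezout a f coprime))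
      1≋ua+vf = proj₂ (proj₂ (coprime⇒bezout a f coprime))

module GaussFactorial (F : FiniteField)
  (1+1≢0 : ¬ FiniteField._+_ F (FiniteField.1# F) (FiniteField.1# F) ≡ FiniteField.0# F)
  (f : Poly.Pol F) (k : ℕ) (deg⁺f≡ : Polynomials.deg⁺ F f ≡ suc (suc k))
  (L : List (Poly.Pol F)) (gauss : Poly.GaussEnumeration F f L) where

  open FiniteField F using (_+_; 0#; 1#)
  open Poly F
  open Polynomials F

  open IntegerCoefficientSolver polyRing
  open Congruence f k deg⁺f≡
  open CommutativeRing residueRing using (*-commutativeMonoid)
  open InvolutionProducts *-commutativeMonoid
  open SetoidReasoning (CommutativeRing.setoid residueRing)

  L-residues : All (λ g → DegBelow g (suc k)) L
  L-residues = All.map (λ g∈G → deg<⇒DegBelow (proj₁ (proj₂ g∈G))) (proj₁ gauss)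

  L-distinct : Distinct L
  L-distinct = distinct L (proj₁ (proj₂ gauss)) L-residues
    where
    distinct : ∀ xs → AllPairs (λ a b → ¬ a ≈ b) xs → All (λ g → DegBelow g (suc k)) xs → Distinct xs
    distinct []       []           []           = []
    distinct (x ∷ xs) (x∉xs ∷ dxs) (x<k ∷ xs<k) =
      All.zipWith (λ { (x≉y , y<k) x≈ₘy → x≉y (coeff≡ (≈ₘ-small⇒≋ x≈ₘy x<k y<k)) }) (x∉xs , xs<k) ∷ distinct xs dxs xs<k

  L-complete : ∀ {h h′} → (h ⊗ h′) ≈ₘ oneP → Any (h ≈ₘ_) L
  L-complete {h} {h′} hh′≈1 = Any.map (λ r≈y → ≈ₘ-trans (≈ₘ-sym r≈h) (≋⇒≈ₘ ⟪ r≈y ⟫)) (proj₂ (proj₂ gauss) r r∈G)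
    where
    r = proj₁ (reduce h)
    r≈h = proj₁ (proj₂ (reduce h))
    rh′≈1 : (r ⊗ h′) ≈ₘ oneP
    rh′≈1 = ≈ₘ-trans (≈ₘ-⊗ r≈h (≈ₘ-refl {h′})) hh′≈1
    r≉0 : ¬ r ≋ []
    r≉0 r≋0 = 1≉ₘ0 (≈ₘ-trans (≈ₘ-sym rh′≈1) (≋⇒≈ₘ (⊗-zeroˡ h′ r≋0)))
    r∈G : GaussIndex f r
    r∈G = r≉0 ∘ ⟪_⟫
        , DegBelow⇒deg< r≉0 (proj₂ (proj₂ (reduce h)))
        , λ d d∣r d∣f → ∣′⇒∣ (invertible⇒coprime {r} {h′} rh′≈1 d (∣⇒∣′ {d} {r} d∣r) (∣⇒∣′ {d} {f} d∣f))

  L-inverses : All (λ x → Any (λ y → (x ⊗ y) ≈ₘ oneP) L) L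
  L-inverses = All.map (λ {x} → inverse-in-L {x}) (proj₁ gauss)
    where
    inverse-in-L : ∀ {x} → GaussIndex f x → Any (λ y → (x ⊗ y) ≈ₘ oneP) L
    inverse-in-L {x} (_ , _ , coprime) =
      Any.map (λ u≈y → ≈ₘ-trans (≈ₘ-⊗ (≈ₘ-refl {x}) (≈ₘ-sym u≈y)) xu≈1)
              (L-complete {u} {x} (≈ₘ-trans (≋⇒≈ₘ (⊗-comm u x)) xu≈1))
      where
      inverse = coprime⇒invertible {x} λ d d∣x d∣f → ∣⇒∣′ {d} {oneP} (coprime d (∣′⇒∣ d∣x) (∣′⇒∣ d∣f))
      u = proj₁ inverse
      xu≈1 = proj₂ inverse

  SelfInverse : Pol → Set
  SelfInverse x = (x ⊗ x) ≈ₘ oneP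

  selfInverse? : Decidable SelfInverse
  selfInverse? x = (x ⊗ x) ≈ₘ? oneP

  T : List Pol
  T = filter selfInverse? L

  T-distinct : Distinct T
  T-distinct = AllPairs.filter⁺ selfInverse? L-distinct

  T-selfInverse : All SelfInverse T
  T-selfInverse = All.all-filter selfInverse? L

  T-complete : ∀ {x} → SelfInverse x → Any (x ≈ₘ_) T
  T-complete {x} xx≈1 = Any-filter⁺ selfInverse? (λ x≈y → ≈ₘ-trans (≈ₘ-⊗ (≈ₘ-sym x≈y) (≈ₘ-sym x≈y)) xx≈1) (L-complete xx≈1)

  -- Pairing each residue with its inverse leaves the self-inverse ones.
  G≈∏T : prodP L ≈ₘ ∏ T
  G≈∏T = ≈ₘ-trans ∏≈ (≈ₘ-trans (≈ₘ-⊗ (×ᵐ-ε pairs) (≈ₘ-refl {∏ T})) (≋⇒≈ₘ (⊗-identityˡ (∏ T))))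
    where
    Inverse : Rel Pol _
    Inverse x y = (x ⊗ y) ≈ₘ oneP
    inverse-functional : ∀ {x y z} → Inverse x y → Inverse x z → y ≈ₘ z
    inverse-functional {x} {y} {z} xy≈1 xz≈1 = begin
      y                 ≈⟨ ≋⇒≈ₘ (⊗-identityʳ y) ⟨
      (y ⊗ oneP)     ≈⟨ ≈ₘ-⊗ (≈ₘ-refl {y}) xz≈1 ⟨
      (y ⊗ (x ⊗ z))  ≈⟨ ≋⇒≈ₘ (solve 3 (λ y x z → y :* (x :* z) := (x :* y) :* z) ≋-refl y x z) ⟩
      ((x ⊗ y) ⊗ z)  ≈⟨ ≈ₘ-⊗ xy≈1 (≈ₘ-refl {z}) ⟩
      (oneP ⊗ z)     ≈⟨ ≋⇒≈ₘ (⊗-identityˡ z) ⟩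
      z              ∎
    open Pairing Inverse (λ _ → ⊤) (λ {x} {y} → ≈ₘ-trans (≋⇒≈ₘ (⊗-comm y x)))
      (λ {x} {y} {z} → inverse-functional {x} {y} {z}) selfInverse? oneP (λ _ xy≈1 → xy≈1)
    open Paired (pairing L L-distinct (All.tabulate _) L-inverses)

  -- For self-inverse b ≉ 1, x ↦ b x is a fixed-point-free involution of T.
  pairedBy : ∀ b → SelfInverse b → ¬ b ≈ₘ oneP → Σ ℕ λ n → length T ≡ n ℕ.+ n × ∏ T ≈ₘ n ×ᵐ b
  pairedBy b bb≈1 b≉1 = pairing-fixedPointFree T T-distinct T-selfInverse
    (All.map (λ xx≈1 → Any.map ≈ₘ-sym (T-complete (bx-selfInverse xx≈1))) T-selfInverse)
    (All.map no-fixed-point T-selfInverse)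
    where
    Times-b : Rel Pol _
    Times-b x y = y ≈ₘ (b ⊗ x)
    times-b-sym : Symmetric Times-b
    times-b-sym {x} {y} y≈bx = ≈ₘ-sym (begin
      (b ⊗ y)        ≈⟨ ≈ₘ-⊗ (≈ₘ-refl {b}) y≈bx ⟩
      (b ⊗ (b ⊗ x))  ≈⟨ ≋⇒≈ₘ (⊗-assoc b b x) ⟨
      ((b ⊗ b) ⊗ x)  ≈⟨ ≈ₘ-⊗ bb≈1 (≈ₘ-refl {x}) ⟩
      (oneP ⊗ x)     ≈⟨ ≋⇒≈ₘ (⊗-identityˡ x) ⟩
      x                 ∎)
    times-b-∙ : ∀ {x y} → SelfInverse x → Times-b x y → (x ⊗ y) ≈ₘ b
    times-b-∙ {x} {y} xx≈1 y≈bx = begin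
      (x ⊗ y)        ≈⟨ ≈ₘ-⊗ (≈ₘ-refl {x}) y≈bx ⟩
      (x ⊗ (b ⊗ x))  ≈⟨ ≋⇒≈ₘ (solve 2 (λ x b → x :* (b :* x) := b :* (x :* x)) ≋-refl x b) ⟩
      (b ⊗ (x ⊗ x))  ≈⟨ ≈ₘ-⊗ (≈ₘ-refl {b}) xx≈1 ⟩
      (b ⊗ oneP)     ≈⟨ ≋⇒≈ₘ (⊗-identityʳ b) ⟩
      b              ∎
    no-fixed-point : ∀ {x} → SelfInverse x → ¬ Times-b x x
    no-fixed-point {x} xx≈1 x≈bx = b≉1 (≈ₘ-trans (≈ₘ-sym (times-b-∙ xx≈1 x≈bx)) xx≈1)
    bx-selfInverse : ∀ {x} → SelfInverse x → SelfInverse (b ⊗ x)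
    bx-selfInverse {x} xx≈1 = begin
      ((b ⊗ x) ⊗ (b ⊗ x))  ≈⟨ ≋⇒≈ₘ (solve 2 (λ b x → (b :* x) :* (b :* x) := (b :* b) :* (x :* x)) ≋-refl b x) ⟩
      ((b ⊗ b) ⊗ (x ⊗ x))  ≈⟨ ≈ₘ-⊗ bb≈1 xx≈1 ⟩
      (oneP ⊗ oneP)        ≈⟨ ≋⇒≈ₘ (⊗-identityˡ oneP) ⟩
      oneP                 ∎
    open Pairing Times-b SelfInverse (λ {x} {y} → times-b-sym {x} {y}) (λ y≈bx z≈bx → ≈ₘ-trans y≈bx (≈ₘ-sym z≈bx))
      (λ x → x ≈ₘ? (b ⊗ x)) b times-b-∙

  ∏T≈power : ∀ {n} → length T ≡ n ℕ.+ n → ∀ b → SelfInverse b → ¬ b ≈ₘ oneP → ∏ T ≈ₘ n ×ᵐ b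
  ∏T≈power {n} length≡n+n b bb≈1 b≉1 =
    ≡.subst (λ m → ∏ T ≈ₘ m ×ᵐ b)
      (double-injective {proj₁ paired} {n} (≡.trans (≡.sym (proj₁ (proj₂ paired))) length≡n+n))
      (proj₂ (proj₂ paired))
    where
    paired = pairedBy b bb≈1 b≉1
    double-injective : ∀ {m n} → m ℕ.+ m ≡ n ℕ.+ n → m ≡ n
    double-injective {m} {n} m+m≡n+n = ℕ.*-cancelˡ-≡ m n 2
      (≡.trans (≡.cong (m ℕ.+_) (ℕ.+-identityʳ m)) (≡.trans m+m≡n+n (≡.sym (≡.cong (n ℕ.+_) (ℕ.+-identityʳ n)))))

  -1P-selfInverse : SelfInverse -1P
  -1P-selfInverse = ≋⇒≈ₘ (≋-trans (solve 1 (λ y → (:- y) :* (:- y) := y :* y) ≋-refl oneP) (⊗-identityˡ oneP))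

  G≈-1 : (∀ x → SelfInverse x → x ≈ₘ oneP ⊎ x ≈ₘ -1P) → prodP L ≈ₘ -1P
  G≈-1 only-±1 = begin
    prodP L  ≈⟨ G≈∏T ⟩
    ∏ T      ≈⟨ ∏-twoClasses T (1≉ₘ-1 1+1≢0) T-distinct (All.map (only-±1 _) T-selfInverse)
                                   (T-complete (≋⇒≈ₘ (⊗-identityˡ oneP))) (T-complete -1P-selfInverse) ⟩
    (oneP ⊗ -1P)   ≈⟨ ≋⇒≈ₘ (⊗-identityˡ -1P) ⟩
    -1P            ∎

  -- With a third square root a of 1, ∏ T is simultaneously (-1)ⁿ, aⁿ and (-a)ⁿ.
  G≈1 : ∀ a → SelfInverse a → ¬ a ≈ₘ oneP → ¬ a ≈ₘ -1P → prodP L ≈ₘ oneP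
  G≈1 a aa≈1 a≉1 a≉-1 = begin
    prodP L                  ≈⟨ G≈∏T ⟩
    ∏ T                      ≈⟨ ∏T≈power {n} T≡n+n (negP a) -a-selfInverse -a≉1 ⟩
    n ×ᵐ negP a              ≈⟨ ×-congʳ n (≋⇒≈ₘ (solve 1 (λ a → :- a := (:- con (1 , 0)) :* a) ≋-refl a)) ⟩
    n ×ᵐ (-1P ⊗ a)           ≈⟨ ×-distrib-+ -1P a n ⟩
    (n ×ᵐ -1P) ⊗ (n ×ᵐ a)    ≈⟨ ≈ₘ-⊗ (≈ₘ-refl {n ×ᵐ -1P}) (∏T≈power {n} T≡n+n a aa≈1 a≉1) ⟨
    (n ×ᵐ -1P) ⊗ ∏ T         ≈⟨ ≈ₘ-⊗ (≈ₘ-refl {n ×ᵐ -1P}) ∏T≈-1ⁿ ⟩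
    (n ×ᵐ -1P) ⊗ (n ×ᵐ -1P)  ≈⟨ ×-distrib-+ -1P -1P n ⟨
    n ×ᵐ (-1P ⊗ -1P)         ≈⟨ ×-congʳ n -1P-selfInverse ⟩
    n ×ᵐ oneP                ≈⟨ ×ᵐ-ε n ⟩
    oneP                     ∎
    where
    -1≉1 : ¬ -1P ≈ₘ oneP
    -1≉1 = 1≉ₘ-1 1+1≢0 ∘ ≈ₘ-sym
    n = proj₁ (pairedBy -1P -1P-selfInverse -1≉1)
    T≡n+n : length T ≡ n ℕ.+ n
    T≡n+n = proj₁ (proj₂ (pairedBy -1P -1P-selfInverse -1≉1))
    ∏T≈-1ⁿ : ∏ T ≈ₘ n ×ᵐ -1P
    ∏T≈-1ⁿ = proj₂ (proj₂ (pairedBy -1P -1P-selfInverse -1≉1))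
    -a-selfInverse : SelfInverse (negP a)
    -a-selfInverse = ≈ₘ-trans (≋⇒≈ₘ (solve 1 (λ a → (:- a) :* (:- a) := a :* a) ≋-refl a)) aa≈1
    -a≉1 : ¬ negP a ≈ₘ oneP
    -a≉1 -a≈1 = a≉-1 (≈ₘ-trans (≋⇒≈ₘ (solve 1 (λ a → a := :- (:- a)) ≋-refl a)) (≈ₘ-negP -a≈1))

module SquareRootsOfUnity (F : FiniteField)
  (1+1≢0 : ¬ FiniteField._+_ F (FiniteField.1# F) (FiniteField.1# F) ≡ FiniteField.0# F)
  (f : Poly.Pol F) (k : ℕ) (deg⁺f≡ : Polynomials.deg⁺ F f ≡ suc (suc k)) where

  open FiniteField F using (_+_; 0#; 1#)
  open Poly F
  open Polynomials F

  open IntegerCoefficientSolver polyRing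
  open Congruence f k deg⁺f≡
  open import Algebra.Definitions.RawSemiring (RawRing.rawSemiring (CommutativeRing.rawRing polyRing)) using () renaming (_^_ to _^ₚ_)

  x²≈1⇒f∣[x-1][x+1] : ∀ x → (x ⊗ x) ≈ₘ oneP → f ∣′ ((x ⊕ -1P) ⊗ (x ⊕ oneP))
  x²≈1⇒f∣[x-1][x+1] x (mod f∣x²-1) = ∣′-respʳ (≋-sym [x-1][x+1]≋x²-1) f∣x²-1
    where
    [x-1][x+1]≋x²-1 : ((x ⊕ -1P) ⊗ (x ⊕ oneP)) ≋ ((x ⊗ x) ⊖ oneP)
    [x-1][x+1]≋x²-1 = ≋-trans (solve 2 (λ x y → (x :- y) :* (x :+ y) := x :* x :- y :* y) ≋-refl x oneP)
                             (⊕-cong (≋-refl {x ⊗ x}) (negP-cong (⊗-identityˡ oneP)))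

  -- If f = Pᵉ, the prime P divides x - 1 or x + 1 but not both; the other factor is then prime to f.
  onePrime⇒roots±1 : OnePrimeDivisor f → ∀ x → (x ⊗ x) ≈ₘ oneP → x ≈ₘ oneP ⊎ x ≈ₘ -1P
  onePrime⇒roots±1 (P , (_ , P-irreducible₀ , P∣f₀) , only-P) x x²≈1 =
    cases (irreducible⇒prime P-irreducible _ _ (∣′-trans P∣f (x²≈1⇒f∣[x-1][x+1] x x²≈1)))
    where
    P-irreducible = Irreducible⇒Irreducible′ P-irreducible₀
    P∣f = ∣⇒∣′ {P} {f} P∣f₀
    coprime-to-f : ∀ {D} → ¬ P ∣′ D → Coprime′ f D
    coprime-to-f P∤D = no-common-monicIrreducible⇒coprime f≉0 λ Q Q-monic Q-irreducible Q∣f Q∣D →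
      P∤D (∣′-respˡ ⟪ only-P Q (Q-monic , Irreducible′⇒Irreducible Q-irreducible , ∣′⇒∣ Q∣f) ⟫ Q∣D)
    P∤both : P ∣′ (x ⊕ -1P) → ¬ P ∣′ (x ⊕ oneP)
    P∤both P∣x-1 P∣x+1 = nonunit∤both-x±1 1+1≢0 x (proj₁ (proj₂ P-irreducible)) P∣x+1 P∣x-1
    cases : P ∣′ (x ⊕ -1P) ⊎ P ∣′ (x ⊕ oneP) → x ≈ₘ oneP ⊎ x ≈ₘ -1P
    cases (inj₁ P∣x-1) = inj₁ (mod (euclid (coprime-to-f (P∤both P∣x-1)) (x²≈1⇒f∣[x-1][x+1] x x²≈1)))
    cases (inj₂ P∣x+1) = inj₂ (mod (∣′-respʳ (solve 2 (λ x y → x :+ y := x :- (:- y)) ≋-refl x oneP)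
      (euclid (coprime-to-f (λ P∣x-1 → P∤both P∣x-1 P∣x+1))
              (∣′-respʳ (⊗-comm (x ⊕ -1P) (x ⊕ oneP)) (x²≈1⇒f∣[x-1][x+1] x x²≈1)))))

  deg⁺-cofactor< : ∀ {P g h i} → deg⁺ P ≡ suc (suc i) → ¬ g ≋ [] → g ≋ (P ⊗ h) → deg⁺ h < deg⁺ g
  deg⁺-cofactor< {P} {g} {h} {i} deg⁺P≡ g≉0 g≋Ph with deg⁺ h in deg⁺h≡
  ... | zero  = contradiction (≋-trans g≋Ph (≋-trans (⊗-congʳ P (deg⁺≡0⇒≋0 {h} deg⁺h≡)) (⊗-zeroʳ P))) g≉0
  ... | suc j = ≡.subst (suc j <_) (≡.sym (≡.trans (deg⁺-cong g≋Ph) (deg⁺-⊗ {P} {h} deg⁺P≡ deg⁺h≡)))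
                        (s≤s (s≤s (ℕ.m≤n+m j i)))

  split-power : ∀ {P i} → deg⁺ P ≡ suc (suc i) → ∀ g → ¬ g ≋ [] → ∃ λ e → ∃ λ m → g ≋ ((P ^ₚ e) ⊗ m) × ¬ P ∣′ m
  split-power {P} deg⁺P≡ g = <-rec Goal step (deg⁺ g) g ≡.refl
    where
    Goal : ℕ → Set
    Goal n = ∀ g → deg⁺ g ≡ n → ¬ g ≋ [] → ∃ λ e → ∃ λ m → g ≋ ((P ^ₚ e) ⊗ m) × ¬ P ∣′ m
    step : ∀ n → (∀ {m} → m < n → Goal m) → Goal n
    step n rec g ≡.refl g≉0 = cases (P ∣′? g)
      where
      cases : Dec (P ∣′ g) → ∃ λ e → ∃ λ m → g ≋ ((P ^ₚ e) ⊗ m) × ¬ P ∣′ m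
      cases (no P∤g) = 0 , g , ≋-sym (⊗-identityˡ g) , P∤g
      cases (yes (divides h g≋Ph)) =
        let h≉0 = λ h≋0 → g≉0 (≋-trans g≋Ph (≋-trans (⊗-congʳ P h≋0) (⊗-zeroʳ P)))
            e , m , h≋Pᵉm , P∤m = rec (deg⁺-cofactor< {P} {g} {h} deg⁺P≡ g≉0 g≋Ph) h ≡.refl h≉0
        in suc e , m , ≋-trans g≋Ph (≋-trans (⊗-congʳ P h≋Pᵉm) (≋-sym (⊗-assoc P (P ^ₚ e) m))) , P∤m

  irreducible-∣′-power : ∀ {P Q} → Irreducible′ Q → ∀ e → Q ∣′ (P ^ₚ e) → Q ∣′ P
  irreducible-∣′-power (_ , Q-nonunit , _)   zero    Q∣1    = contradiction Q∣1 Q-nonunit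
  irreducible-∣′-power {P} Q-irreducible (suc e) Q∣Pᵉ⁺¹ =
    Sum.[ id , irreducible-∣′-power Q-irreducible e ] (irreducible⇒prime Q-irreducible P (P ^ₚ e) Q∣Pᵉ⁺¹)

  -- Write f = Pᵉ m with P ∤ m; then m is not a unit, Pᵉ and m are coprime, and the
  -- Chinese remainder theorem gives a ≡ 1 (mod Pᵉ), a ≡ -1 (mod m).
  severalPrimes⇒nontrivialRoot : ¬ OnePrimeDivisor f → ∃ λ a → (a ⊗ a) ≈ₘ oneP × ¬ a ≈ₘ oneP × ¬ a ≈ₘ -1P
  severalPrimes⇒nontrivialRoot ¬one = a , a²≈1 , a≉1 , a≉-1
    where
    factor = monicIrreducibleFactor f f≉0 f-nonunit
    P = proj₁ factor
    P-monic = proj₁ (proj₂ factor)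
    P-irreducible = proj₁ (proj₂ (proj₂ factor))
    P∣f = proj₂ (proj₂ (proj₂ factor))
    split = split-power (proj₂ (nonzero-nonunit⇒deg⁺≥2 (proj₁ P-irreducible) (proj₁ (proj₂ P-irreducible)))) f f≉0
    e = proj₁ split
    m = proj₁ (proj₂ split)
    f≋Pᵉm : f ≋ ((P ^ₚ e) ⊗ m)
    f≋Pᵉm = proj₁ (proj₂ (proj₂ split))
    P∤m : ¬ P ∣′ m
    P∤m = proj₂ (proj₂ (proj₂ split))
    Pᵉ = P ^ₚ e
    only-P : ∀ Q → Monic Q → Irreducible′ Q → Q ∣′ Pᵉ → Q ≋ P
    only-P Q Q-monic Q-irreducible Q∣Pᵉ =
      monicIrreducible-∣′⇒≋ P-monic Q-monic P-irreducible Q-irreducible (irreducible-∣′-power Q-irreducible e Q∣Pᵉ)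
    m-nonunit : ¬ Unit m
    m-nonunit (divides m′ 1≋mm′) = ¬one (P , (P-monic , Irreducible′⇒Irreducible P-irreducible , ∣′⇒∣ P∣f) , only)
      where
      Pᵉ≋fm′ : Pᵉ ≋ (f ⊗ m′)
      Pᵉ≋fm′ = ≋-trans (≋-sym (⊗-identityʳ Pᵉ)) (≋-trans (⊗-congʳ Pᵉ 1≋mm′)
               (≋-trans (≋-sym (⊗-assoc Pᵉ m m′)) (⊗-congˡ m′ (≋-sym f≋Pᵉm))))
      only : ∀ Q → PrimeDivisor Q f → Q ≈ P
      only Q (Q-monic , Q-irreducible , Q∣f) = coeff≡ (only-P Q Q-monic (Irreducible⇒Irreducible′ Q-irreducible)
        (∣′-respʳ (≋-sym Pᵉ≋fm′) (∣′-⊗ʳ (∣⇒∣′ {Q} {f} Q∣f) m′)))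
    Pᵉ-nonunit : ¬ Unit Pᵉ
    Pᵉ-nonunit = nonunit e f≋Pᵉm
      where
      nonunit : ∀ e′ → f ≋ ((P ^ₚ e′) ⊗ m) → ¬ Unit (P ^ₚ e′)
      nonunit zero    f≋1m _       = P∤m (∣′-respʳ (≋-trans f≋1m (⊗-identityˡ m)) P∣f)
      nonunit (suc _) _    Pᵉ-unit = proj₁ (proj₂ P-irreducible) (∣′-trans (p∣′p⊗q P _) Pᵉ-unit)
    coprime : Coprime′ Pᵉ m
    coprime = no-common-monicIrreducible⇒coprime (λ Pᵉ≋0 → f≉0 (≋-trans f≋Pᵉm (⊗-zeroˡ m Pᵉ≋0)))
      λ Q Q-monic Q-irreducible Q∣Pᵉ Q∣m → P∤m (∣′-respˡ (only-P Q Q-monic Q-irreducible Q∣Pᵉ) Q∣m)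
    α = proj₁ (coprime⇒bezout Pᵉ m coprime)
    β = proj₁ (proj₂ (coprime⇒bezout Pᵉ m coprime))
    1≋αPᵉ+βm : oneP ≋ ((α ⊗ Pᵉ) ⊕ (β ⊗ m))
    1≋αPᵉ+βm = proj₂ (proj₂ (coprime⇒bezout Pᵉ m coprime))
    a : Pol
    a = (α ⊗ Pᵉ) ⊖ (β ⊗ m)
    a-1≋ : (a ⊕ -1P) ≋ (m ⊗ negP (β ⊕ β))
    a-1≋ = ≋-trans (⊕-cong (≋-refl {a}) (negP-cong 1≋αPᵉ+βm))
      (solve 4 (λ α u β v → (α :* u :- β :* v) :- (α :* u :+ β :* v) := v :* (:- (β :+ β))) ≋-refl α Pᵉ β m)
    a+1≋ : (a ⊕ oneP) ≋ (Pᵉ ⊗ (α ⊕ α))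
    a+1≋ = ≋-trans (⊕-cong (≋-refl {a}) 1≋αPᵉ+βm)
      (solve 4 (λ α u β v → (α :* u :- β :* v) :+ (α :* u :+ β :* v) := u :* (α :+ α)) ≋-refl α Pᵉ β m)
    Pᵉ∣f : Pᵉ ∣′ f
    Pᵉ∣f = ∣′-respʳ (≋-sym f≋Pᵉm) (p∣′p⊗q Pᵉ m)
    m∣f : m ∣′ f
    m∣f = ∣′-respʳ (≋-trans (⊗-comm m Pᵉ) (≋-sym f≋Pᵉm)) (p∣′p⊗q m Pᵉ)
    a²≈1 : (a ⊗ a) ≈ₘ oneP
    a²≈1 = mod (∣′-respˡ (≋-sym f≋Pᵉm) (∣′-respʳ (≋-sym a²-1≋) (p∣′p⊗q (Pᵉ ⊗ m) _)))
      where
      a²-1≋ : ((a ⊗ a) ⊖ oneP) ≋ ((Pᵉ ⊗ m) ⊗ negP (((α ⊗ β) ⊕ (α ⊗ β)) ⊕ ((α ⊗ β) ⊕ (α ⊗ β))))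
      a²-1≋ = begin
        ((a ⊗ a) ⊖ oneP)
          ≈⟨ ⊕-cong (≋-refl {a ⊗ a}) (negP-cong (≋-trans (≋-sym (⊗-identityˡ oneP)) (⊗-cong 1≋αPᵉ+βm 1≋αPᵉ+βm))) ⟩
        ((a ⊗ a) ⊖ (((α ⊗ Pᵉ) ⊕ (β ⊗ m)) ⊗ ((α ⊗ Pᵉ) ⊕ (β ⊗ m))))
          ≈⟨ solve 4 (λ α u β v → ((α :* u :- β :* v) :* (α :* u :- β :* v)) :- ((α :* u :+ β :* v) :* (α :* u :+ β :* v))
                                   := (u :* v) :* (:- ((α :* β :+ α :* β) :+ (α :* β :+ α :* β)))) ≋-refl α Pᵉ β m ⟩
        ((Pᵉ ⊗ m) ⊗ negP (((α ⊗ β) ⊕ (α ⊗ β)) ⊕ ((α ⊗ β) ⊕ (α ⊗ β))))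
          ∎
        where open SetoidReasoning ≋-setoid
    a≉1 : ¬ a ≈ₘ oneP
    a≉1 (mod f∣a-1) = nonunit∤both-x±1 1+1≢0 a Pᵉ-nonunit (∣′-respʳ (≋-sym a+1≋) (p∣′p⊗q Pᵉ _)) (∣′-trans Pᵉ∣f f∣a-1)
    a≉-1 : ¬ a ≈ₘ -1P
    a≉-1 (mod f∣a+1) = nonunit∤both-x±1 1+1≢0 a m-nonunit
      (∣′-trans m∣f (∣′-respʳ (solve 2 (λ a y → a :- (:- y) := a :+ y) ≋-refl a oneP) f∣a+1))
      (∣′-respʳ (≋-sym a-1≋) (p∣′p⊗q m _))

^-odd : ∀ p s → p % 2 ≡ 1 → (p ^ s) % 2 ≡ 1
^-odd p zero    _     = ≡.refl
^-odd p (suc s) p-odd = ≡.trans (%-distribˡ-* p (p ^ s) 2) (≡.cong₂ (λ a b → (a ℕ.* b) % 2) p-odd (^-odd p s p-odd))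

pred≥1⇒≥2 : ∀ n → 1 ℕ.≤ n ∸ 1 → ∃ λ k → n ≡ suc (suc k)
pred≥1⇒≥2 (suc (suc k)) _ = k , ≡.refl

theorem3p1 : (F : FiniteField) (p s : ℕ) → Prime p → p % 2 ≡ 1 → s ≥ 1
           → FiniteField.size F ≡ p ^ s
           → (f : Poly.Pol F) → Poly.deg F f ≥ 1
           → (L : List (Poly.Pol F)) → Poly.GaussEnumeration F f L
           → (Poly.OnePrimeDivisor F f → Poly._≡_[mod_] F (Poly.prodP F L) (Poly.negP F (Poly.oneP F)) f)
           × (¬ Poly.OnePrimeDivisor F f → Poly._≡_[mod_] F (Poly.prodP F L) (Poly.oneP F) f)
theorem3p1 F p s _ p-odd _ size≡pˢ f deg-f≥1 L gauss = one-prime , several-primes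
  where
  open Polynomials F using (deg⁺; ∣′⇒∣)
  1+1≢0 = FieldFacts.odd-size⇒1+1≢0 F (≡.subst (_≡ 1) (≡.cong (_% 2) (≡.sym size≡pˢ)) (^-odd p s p-odd))
  k = proj₁ (pred≥1⇒≥2 (deg⁺ f) deg-f≥1)
  deg⁺f≡ = proj₂ (pred≥1⇒≥2 (deg⁺ f) deg-f≥1)
  open Polynomials.Congruence F f k deg⁺f≡ using (f∣′a⊖b)
  open GaussFactorial F 1+1≢0 f k deg⁺f≡ L gauss using (G≈-1; G≈1)
  open SquareRootsOfUnity F 1+1≢0 f k deg⁺f≡ using (onePrime⇒roots±1; severalPrimes⇒nontrivialRoot)
  one-prime = λ one → ∣′⇒∣ (f∣′a⊖b (G≈-1 (onePrime⇒roots±1 one)))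
  several-primes = λ ¬one →
    let a , a²≈1 , a≉1 , a≉-1 = severalPrimes⇒nontrivialRoot ¬one
    in ∣′⇒∣ (f∣′a⊖b (G≈1 a a²≈1 a≉1 a≉-1))
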